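{- For any graph $G$ (with complement $\overline{G}$, and with $\overline{M}(G)$ denoting the complement of the Mycielski graph $M(G)$): (a) $i_4(\overline{G})\leq 4$ if and only if $p_v(\overline{M}(G))=1$; (b) for every integer $r\ge 3$, $\lceil i_4(\overline{G})/2\rceil=r$ if and only if $p_v(\overline{M}(G))=r-1$.
   Context: Graphs are finite, simple, undirected. For $G$ with $V=\{v_1,\dots,v_n\}$, the Mycielski graph $M(G)$ has vertex set $V\cup\{v_1',\dots,v_n'\}\cup\{u\}$ and edge set $E\cup\{v_iv_j' : v_iv_j\in E\}\cup\{v_i'u: 1\le i\le n\}$. A 4-star matching of a graph $H$ is a subgraph of $H$ each of whose connected components is isomorphic to a star $K_{1,i}$ with $1\le i\le 4$; $s_4(H)$ is the maximum number of vertices of a 4-star matching of $H$, and $i_4(H)=|V(H)|-s_4(H)$. The path covering number $p_v(H)$ is the smallest number of vertex-disjoint paths covering all vertices of $H$. -}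

module Defs where

open import Data.Nat using (ℕ; zero; suc; _+_; _≤_)
open import Data.Bool using (Bool; true; false; not; _∧_)
open import Data.Fin using (Fin; zero; suc; splitAt; _≟_)
open import Data.Sum using (inj₁; inj₂)
open import Data.List using (List; []; _∷_; length; concat; map; sum)
open import Data.List.Relation.Unary.All using (All)
open import Data.List.Relation.Unary.Linked using (Linked)
open import Data.List.Relation.Unary.Unique.Propositional using (Unique)
open import Data.List.Membership.Propositional using (_∈_)
open import Data.Product using (Σ; _×_)
open import Relation.Binary.PropositionalEquality using (_≡_)
open import Relation.Nullary.Decidable using (⌊_⌋)

Adj : ℕ → Set
Adj n = Fin n → Fin n → Bool

record Graph (n : ℕ) : Set where
  field
    adj    : Adj n
    sym    : ∀ i j → adj i j ≡ adj j i
    irrefl : ∀ i → adj i i ≡ false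
open Graph public

_⊢_~_ : ∀ {n} → Adj n → Fin n → Fin n → Set
A ⊢ i ~ j = A i j ≡ true

complement : ∀ {n} → Adj n → Adj n
complement A i j = not (A i j) ∧ not ⌊ i ≟ j ⌋

-- Mycielski graph.  Vertex set Fin (suc (n + n)):
--   zero              is u,
--   suc k, k = ↑ˡ i   is v_i   (first block of n),
--   suc k, k = n ↑ʳ j is v_j'  (second block of n).
data MVert (n : ℕ) : Set where
  vtx  : Fin n → MVert n
  vtx′ : Fin n → MVert n
  uvtx : MVert n

classify : ∀ {n} → Fin (suc (n + n)) → MVert n
classify zero = uvtx
classify {n} (suc k) with splitAt n k
... | inj₁ i = vtx i
... | inj₂ j = vtx′ j

mycAdj : ∀ {n} → Adj n → MVert n → MVert n → Bool
mycAdj A (vtx i)  (vtx j)  = A i j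
mycAdj A (vtx i)  (vtx′ j) = A i j
mycAdj A (vtx′ i) (vtx j)  = A i j
mycAdj A (vtx′ i) uvtx     = true
mycAdj A uvtx     (vtx′ j) = true
mycAdj A _        _        = false

mycielski : ∀ {n} → Adj n → Adj (suc (n + n))
mycielski A x y = mycAdj A (classify x) (classify y)

-- A star K_{1,i} with 1 ≤ i ≤ 4: a centre and a list of leaves adjacent
-- to it.  (Distinctness of all vertices is imposed in StarMatching.)
record Star4 {n} (A : Adj n) : Set where
  field
    centre  : Fin n
    leaves  : List (Fin n)
    nonempty : 1 ≤ length leaves
    atmost4  : length leaves ≤ 4
    adjacent : All (λ l → A ⊢ centre ~ l) leaves
open Star4 public

starVertices : ∀ {n} {A : Adj n} → Star4 A → List (Fin n)
starVertices s = centre s ∷ leaves s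

record StarMatching {n} (A : Adj n) : Set where
  field
    stars    : List (Star4 A)
    disjoint : Unique (concat (map starVertices stars))
open StarMatching public

smSize : ∀ {n} {A : Adj n} → StarMatching A → ℕ
smSize M = length (concat (map starVertices (stars M)))

IsS4 : ∀ {n} → Adj n → ℕ → Set
IsS4 A k = Σ (StarMatching A) (λ M → smSize M ≡ k)
         × (∀ (M : StarMatching A) → smSize M ≤ k)

-- A path: a nonempty list of vertices, consecutive ones adjacent.
-- (Distinctness is imposed in PathCover.)
record Path {n} (A : Adj n) : Set where
  field
    verts    : List (Fin n)
    nonempty : 1 ≤ length verts
    linked   : Linked (λ x y → A ⊢ x ~ y) verts
open Path public

record PathCover {n} (A : Adj n) : Set where
  field
    paths    : List (Path A)
    disjoint : Unique (concat (map verts paths))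
    covers   : ∀ (v : Fin n) → v ∈ concat (map verts paths)
open PathCover public

IsPathCoverNumber : ∀ {n} → Adj n → ℕ → Set
IsPathCoverNumber A p = Σ (PathCover A) (λ C → length (paths C) ≡ p)
                      × (∀ (C : PathCover A) → p ≤ length (paths C))

-- Write H for the complement of G. In the complement of M(G), v_i v_j is an edge iff ij ∈ H,
-- v_i v′_j is an edge iff i = j or ij ∈ H, the v′_i form a clique, and u is adjacent exactly
-- to the v_i.
--
-- Given a 4-star matching of H, each star is traversed by a path through the v-
-- and v′-copies of its vertices that starts and ends at primed vertices, so through the clique
-- all stars chain into one path. That path also absorbs u and up to four unmatched vertices;
-- the other unmatched vertices x, y are covered in pairs by paths v_x v′_x v′_y v_y. Hence
-- p_v ≤ 1 or 2 p_v ≤ i₄ − 1.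
--
-- Given a cover by p paths, every path edge between unprimed and primed vertices,
-- other than v_x v′_x, projects to an edge of H. In the projected multigraph each x has degree
-- at most 4 (two path edges at v_x, two at v′_x), and such a multigraph has a 4-star matching
-- covering its non-isolated vertices (insert the edges one at a time, repairing the stars). If x
-- is isolated in the projection, v_x is a path end or a neighbour of u, because at most one path
-- edge joins v_x and v′_x; there are 2p path ends and u has at most two neighbours on its path,
-- so i₄ ≤ 2p + 2.
--
-- Together: p_v = 1 if i₄ ≤ 4, and ⌈i₄/2⌉ = p_v + 1 otherwise.

module Submission where

open import Defs hiding (sym)
open import Data.Nat using (ℕ; zero; suc; _+_; _*_; _∸_; _≤_; z≤n; s≤s; _≡ᵇ_; ⌈_/2⌉)
open import Data.Nat.Properties hiding (_≟_)
open import Data.Nat.Tactic.RingSolver using (solve-∀)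
open import Data.Bool using (Bool; true; false; not; _∧_; if_then_else_)
open import Data.Bool.Properties using (T-≡; ∧-idem; ∧-zeroʳ)
open import Data.Empty using (⊥-elim)
open import Data.Fin using (Fin; zero; suc; _↑ˡ_; _↑ʳ_; splitAt; _≟_)
open import Data.Fin.Properties using (splitAt-↑ˡ; splitAt-↑ʳ; splitAt⁻¹-↑ˡ; splitAt⁻¹-↑ʳ)
open import Data.Maybe using (Maybe; just; nothing)
open import Data.Maybe.Relation.Binary.Connected using (Connected; just; just-nothing; nothing-just; nothing)
open import Data.List using (List; []; _∷_; _++_; length; map; concat; head; last; take; drop; filterᵇ; tabulate; allFin)
open import Data.List.Properties using (length-++; map-++; length-map; take++drop≡id)
open import Data.List.Membership.Propositional using (_∈_)
open import Data.List.Membership.Propositional.Properties using (∈-filter⁻; ∈-map⁺)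
open import Data.List.Relation.Unary.All as All using (All; []; _∷_)
open import Data.List.Relation.Unary.All.Properties as Allₚ using ()
open import Data.List.Relation.Unary.Any using (here; there)
open import Data.List.Relation.Unary.Linked as Linked using (Linked; []; [-]; _∷_)
import Data.List.Relation.Unary.Linked.Properties as Linkedₚ
open import Data.List.Relation.Unary.Unique.Propositional using (Unique; []; _∷_)
import Data.List.Relation.Unary.Unique.Propositional.Properties as Uniqueₚ
open import Data.Product using (Σ; _×_; _,_; proj₁; proj₂)
open import Data.Sum using (_⊎_; inj₁; inj₂)
open import Function using (_∘_; Equivalence)
open import Function.Bundles using (_⇔_; mk⇔)
open import Relation.Binary.Definitions using (DecidableEquality)
open import Relation.Binary.PropositionalEquality
open import Relation.Nullary using (yes; no; does; contradiction)
open import Relation.Nullary.Decidable using (dec-true; dec-false; T?; map′; ⌊_⌋; isYes≗does)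

-- Sums and occurrence counts

𝟙 : Bool → ℕ
𝟙 true = 1
𝟙 false = 0

𝟙≤1 : ∀ b → 𝟙 b ≤ 1
𝟙≤1 true = s≤s z≤n
𝟙≤1 false = z≤n

𝟙-∧ˡ : ∀ p q → 𝟙 (p ∧ q) ≤ 𝟙 p
𝟙-∧ˡ true q = 𝟙≤1 q
𝟙-∧ˡ false q = z≤n

𝟙-∧ʳ : ∀ p q → 𝟙 (p ∧ q) ≤ 𝟙 q
𝟙-∧ʳ true q = ≤-refl
𝟙-∧ʳ false q = z≤n

interchange : ∀ a b c d → (a + b) + (c + d) ≡ (a + c) + (b + d)
interchange = solve-∀

sumMap : ∀ {A : Set} → (A → ℕ) → List A → ℕ
sumMap f [] = 0
sumMap f (x ∷ xs) = f x + sumMap f xs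

sumMap-++ : ∀ {A : Set} (f : A → ℕ) (xs ys : List A) → sumMap f (xs ++ ys) ≡ sumMap f xs + sumMap f ys
sumMap-++ f [] ys = refl
sumMap-++ f (x ∷ xs) ys rewrite sumMap-++ f xs ys = sym (+-assoc (f x) _ _)

sumMap-concat : ∀ {A : Set} (f : A → ℕ) (xss : List (List A)) → sumMap f (concat xss) ≡ sumMap (sumMap f) xss
sumMap-concat f [] = refl
sumMap-concat f (xs ∷ xss) rewrite sumMap-++ f xs (concat xss) | sumMap-concat f xss = refl

sumMap-+ : ∀ {A : Set} (f g : A → ℕ) (xs : List A) → sumMap (λ x → f x + g x) xs ≡ sumMap f xs + sumMap g xs
sumMap-+ f g [] = refl
sumMap-+ f g (x ∷ xs) rewrite sumMap-+ f g xs = interchange (f x) (g x) (sumMap f xs) (sumMap g xs)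

sumMap-2* : ∀ {A : Set} (f : A → ℕ) (xs : List A) → sumMap (λ x → 2 * f x) xs ≡ 2 * sumMap f xs
sumMap-2* f [] = refl
sumMap-2* f (x ∷ xs) rewrite sumMap-2* f xs = sym (*-distribˡ-+ 2 (f x) (sumMap f xs))

sumMap-mono : ∀ {A : Set} {f g : A → ℕ} (xs : List A) → (∀ x → f x ≤ g x) → sumMap f xs ≤ sumMap g xs
sumMap-mono [] h = z≤n
sumMap-mono {f = f} {g} (x ∷ xs) h = +-mono-≤ (h x) (sumMap-mono {f = f} {g} xs h)

sumMap-cong : ∀ {A : Set} {f g : A → ℕ} (xs : List A) → (∀ x → f x ≡ g x) → sumMap f xs ≡ sumMap g xs
sumMap-cong [] h = refl
sumMap-cong {f = f} {g} (x ∷ xs) h = cong₂ _+_ (h x) (sumMap-cong {f = f} {g} xs h)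

sumMap-zero : ∀ {A : Set} {f : A → ℕ} (xs : List A) → (∀ x → f x ≡ 0) → sumMap f xs ≡ 0
sumMap-zero [] h = refl
sumMap-zero {f} (x ∷ xs) h rewrite h x = sumMap-zero {f} xs h

sumMap-one : ∀ {A : Set} (xs : List A) → sumMap (λ _ → 1) xs ≡ length xs
sumMap-one [] = refl
sumMap-one (x ∷ xs) = cong suc (sumMap-one xs)

sumMap-filterᵇ : ∀ {A : Set} (p : A → Bool) (f : A → ℕ) (xs : List A) → sumMap f (filterᵇ p xs) ≡ sumMap (λ x → 𝟙 (p x) * f x) xs
sumMap-filterᵇ p f [] = refl
sumMap-filterᵇ p f (x ∷ xs) with p x
... | true = cong₂ _+_ (sym (+-identityʳ (f x))) (sumMap-filterᵇ p f xs)
... | false = sumMap-filterᵇ p f xs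

sumMap-map : ∀ {A B : Set} (f : B → ℕ) (g : A → B) xs → sumMap f (map g xs) ≡ sumMap (λ x → f (g x)) xs
sumMap-map f g [] = refl
sumMap-map f g (x ∷ xs) = cong (f (g x) +_) (sumMap-map f g xs)

sumFin : (n : ℕ) → (Fin n → ℕ) → ℕ
sumFin zero f = 0
sumFin (suc n) f = f zero + sumFin n (λ x → f (suc x))

sumMap-tabulate : ∀ {A : Set} n (f : A → ℕ) (g : Fin n → A) → sumMap f (tabulate g) ≡ sumFin n (λ x → f (g x))
sumMap-tabulate zero f g = refl
sumMap-tabulate (suc n) f g = cong (f (g zero) +_) (sumMap-tabulate n f (λ x → g (suc x)))

sumMap-allFin : ∀ n (f : Fin n → ℕ) → sumMap f (allFin n) ≡ sumFin n f
sumMap-allFin n f = sumMap-tabulate n f (λ x → x)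

sumFin-+ : ∀ n (f g : Fin n → ℕ) → sumFin n (λ x → f x + g x) ≡ sumFin n f + sumFin n g
sumFin-+ zero f g = refl
sumFin-+ (suc n) f g rewrite sumFin-+ n (λ x → f (suc x)) (λ x → g (suc x)) = interchange (f zero) (g zero) _ _

sumFin-mono : ∀ n {f g : Fin n → ℕ} → (∀ x → f x ≤ g x) → sumFin n f ≤ sumFin n g
sumFin-mono zero h = z≤n
sumFin-mono (suc n) h = +-mono-≤ (h zero) (sumFin-mono n (λ x → h (suc x)))

sumFin-cong : ∀ n {f g : Fin n → ℕ} → (∀ x → f x ≡ g x) → sumFin n f ≡ sumFin n g
sumFin-cong zero h = refl
sumFin-cong (suc n) h = cong₂ _+_ (h zero) (sumFin-cong n (λ x → h (suc x)))

sumFin-const : ∀ n k → sumFin n (λ _ → k) ≡ n * k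
sumFin-const zero k = refl
sumFin-const (suc n) k = cong (k +_) (sumFin-const n k)

sumFin-zero : ∀ n {f : Fin n → ℕ} → (∀ x → f x ≡ 0) → sumFin n f ≡ 0
sumFin-zero zero h = refl
sumFin-zero (suc n) h rewrite h zero = sumFin-zero n (λ x → h (suc x))

sumFin-sumMap : ∀ {A : Set} n (f : Fin n → A → ℕ) ys →
  sumFin n (λ x → sumMap (f x) ys) ≡ sumMap (λ y → sumFin n (λ x → f x y)) ys
sumFin-sumMap n f [] = sumFin-zero n (λ _ → refl)
sumFin-sumMap n f (y ∷ ys) = trans (sumFin-+ n (λ x → f x y) (λ x → sumMap (f x) ys))
  (cong (sumFin n (λ x → f x y) +_) (sumFin-sumMap n f ys))

sumFin-single : ∀ n (f : Fin n → ℕ) a → (∀ x → x ≢ a → f x ≡ 0) → sumFin n f ≡ f a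
sumFin-single (suc n) f zero h = trans (cong (f zero +_) (sumFin-zero n (λ x → h (suc x) λ ()))) (+-identityʳ _)
sumFin-single (suc n) f (suc a) h rewrite h zero (λ ()) =
  sumFin-single n (λ x → f (suc x)) a (λ x x≢a → h (suc x) (λ { refl → x≢a refl }))

sumFin-point : ∀ n (f : Fin n → ℕ) a → f a ≤ sumFin n f
sumFin-point (suc n) f zero = m≤m+n _ _
sumFin-point (suc n) f (suc a) = ≤-trans (sumFin-point n (λ x → f (suc x)) a) (m≤n+m _ (f zero))

sumFin-two : ∀ n (f : Fin n → ℕ) a b → a ≢ b → f a + f b ≤ sumFin n f
sumFin-two (suc n) f zero zero a≢b = ⊥-elim (a≢b refl)
sumFin-two (suc n) f zero (suc b) _ = +-monoʳ-≤ (f zero) (sumFin-point n (λ x → f (suc x)) b)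
sumFin-two (suc n) f (suc a) zero _ =
  subst (_≤ sumFin (suc n) f) (+-comm (f zero) _) (+-monoʳ-≤ (f zero) (sumFin-point n (λ x → f (suc x)) a))
sumFin-two (suc n) f (suc a) (suc b) a≢b =
  ≤-trans (sumFin-two n (λ x → f (suc x)) a b (λ { refl → a≢b refl })) (m≤n+m _ (f zero))

sumFin-update : ∀ n (g g′ : Fin n → ℕ) a → (∀ x → x ≢ a → g′ x ≡ g x) → sumFin n g′ + g a ≡ sumFin n g + g′ a
sumFin-update (suc n) g g′ zero h
  rewrite sumFin-cong n {λ x → g′ (suc x)} {λ x → g (suc x)} (λ x → h (suc x) (λ ()))
  = swap (g′ zero) (g zero) (sumFin n (λ x → g (suc x)))
  where
    swap : ∀ p q s → p + s + q ≡ q + s + p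
    swap = solve-∀
sumFin-update (suc n) g g′ (suc a) h rewrite h zero (λ ()) =
  trans (+-assoc (g zero) _ _)
    (trans (cong (g zero +_) (sumFin-update n (λ x → g (suc x)) (λ x → g′ (suc x)) a
                                (λ x x≢a → h (suc x) (λ { refl → x≢a refl }))))
           (sym (+-assoc (g zero) _ _)))

module Occurrences {X : Set} (_≟ₓ_ : DecidableEquality X) where

  -- Via `does`, which `map′` preserves, so that δ (vtx i) (vtx j) computes to δ i j for MVert.
  δ : X → X → ℕ
  δ x y = 𝟙 (does (x ≟ₓ y))

  δ-refl : ∀ x → δ x x ≡ 1
  δ-refl x rewrite dec-true (x ≟ₓ x) refl = refl

  δ-≢ : ∀ {x y} → x ≢ y → δ x y ≡ 0
  δ-≢ {x} {y} x≢y rewrite dec-false (x ≟ₓ y) x≢y = refl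

  does-sym : ∀ x y → does (x ≟ₓ y) ≡ does (y ≟ₓ x)
  does-sym x y with x ≟ₓ y | y ≟ₓ x
  ... | yes _ | yes _ = refl
  ... | no _ | no _ = refl
  ... | yes x≡y | no y≢x = ⊥-elim (y≢x (sym x≡y))
  ... | no x≢y | yes y≡x = ⊥-elim (x≢y (sym y≡x))

  occ : X → List X → ℕ
  occ x = sumMap (δ x)

  occ-++ : ∀ x xs ys → occ x (xs ++ ys) ≡ occ x xs + occ x ys
  occ-++ x = sumMap-++ (δ x)

  occ-concat : ∀ x xss → occ x (concat xss) ≡ sumMap (occ x) xss
  occ-concat x = sumMap-concat (δ x)

  occ-++ˡ : ∀ x xs ys → occ x xs ≤ occ x (xs ++ ys)
  occ-++ˡ x xs ys = subst (occ x xs ≤_) (sym (occ-++ x xs ys)) (m≤m+n _ _)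

  occ-++ʳ : ∀ x xs ys → occ x ys ≤ occ x (xs ++ ys)
  occ-++ʳ x xs ys = subst (occ x ys ≤_) (sym (occ-++ x xs ys)) (m≤n+m _ _)

  ∈⇒occ : ∀ {x xs} → x ∈ xs → 1 ≤ occ x xs
  ∈⇒occ {x} (here refl) rewrite δ-refl x = s≤s z≤n
  ∈⇒occ {x} {y ∷ _} (there x∈xs) = ≤-trans (∈⇒occ x∈xs) (m≤n+m _ (δ x y))

  occ⇒∈ : ∀ x xs → 1 ≤ occ x xs → x ∈ xs
  occ⇒∈ x (y ∷ xs) h with x ≟ₓ y
  ... | yes x≡y = here x≡y
  ... | no _ = there (occ⇒∈ x xs h)

  ∉⇒occ≡0 : ∀ x xs → All (x ≢_) xs → occ x xs ≡ 0
  ∉⇒occ≡0 x [] [] = refl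
  ∉⇒occ≡0 x (y ∷ xs) (x≢y ∷ x∉xs) rewrite δ-≢ x≢y = ∉⇒occ≡0 x xs x∉xs

  occ≡0⇒∉ : ∀ x xs → occ x xs ≡ 0 → All (x ≢_) xs
  occ≡0⇒∉ x [] h = []
  occ≡0⇒∉ x (y ∷ xs) h with x ≟ₓ y
  ... | no x≢y = x≢y ∷ occ≡0⇒∉ x xs h

  Unique⇒occ≤1 : ∀ {xs} → Unique xs → ∀ x → occ x xs ≤ 1
  Unique⇒occ≤1 [] x = z≤n
  Unique⇒occ≤1 {y ∷ xs} (y∉xs ∷ u) x with x ≟ₓ y
  ... | no _ = Unique⇒occ≤1 u x
  ... | yes refl rewrite ∉⇒occ≡0 x xs y∉xs = s≤s z≤n

  occ≤1⇒Unique : ∀ xs → (∀ x → occ x xs ≤ 1) → Unique xs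
  occ≤1⇒Unique [] h = []
  occ≤1⇒Unique (y ∷ xs) h = occ≡0⇒∉ y xs (n≤0⇒n≡0 (≤-pred y-once)) ∷ occ≤1⇒Unique xs (λ x → ≤-trans (m≤n+m _ _) (h x))
    where
      y-once : 1 + occ y xs ≤ 1
      y-once = subst (λ k → k + occ y xs ≤ 1) (δ-refl y) (h y)

module OccFin {n : ℕ} = Occurrences (_≟_ {n})
open OccFin public using (does-sym; δ; δ-refl; δ-≢; occ)

sumFin-δ : ∀ n (y : Fin n) → sumFin n (λ x → δ x y) ≡ 1
sumFin-δ n y = trans (sumFin-single n _ y (λ x x≢y → δ-≢ x≢y)) (δ-refl y)

sumFin-occ : ∀ n (ys : List (Fin n)) → sumFin n (λ x → occ x ys) ≡ length ys
sumFin-occ n ys = trans (sumFin-sumMap n δ ys) (trans (sumMap-cong ys (sumFin-δ n)) (sumMap-one ys))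

occ-filterᵇ-allFin : ∀ {n} (p : Fin n → Bool) x → occ x (filterᵇ p (allFin n)) ≡ 𝟙 (p x)
occ-filterᵇ-allFin {n} p x = begin
  occ x (filterᵇ p (allFin n))              ≡⟨ sumMap-filterᵇ p (δ x) (allFin n) ⟩
  sumMap (λ y → 𝟙 (p y) * δ x y) (allFin n) ≡⟨ sumMap-allFin n _ ⟩
  sumFin n (λ y → 𝟙 (p y) * δ x y)          ≡⟨ sumFin-single n _ x (λ y y≢x → trans (cong (𝟙 (p y) *_) (δ-≢ (≢-sym y≢x))) (*-zeroʳ (𝟙 (p y)))) ⟩
  𝟙 (p x) * δ x x                           ≡⟨ cong (𝟙 (p x) *_) (δ-refl x) ⟩
  𝟙 (p x) * 1                               ≡⟨ *-identityʳ _ ⟩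
  𝟙 (p x)                                   ∎
  where open ≡-Reasoning

-- The vertices of M(G)

vtx-injective : ∀ {n} {i j : Fin n} → vtx i ≡ vtx j → i ≡ j
vtx-injective refl = refl

vtx′-injective : ∀ {n} {i j : Fin n} → vtx′ i ≡ vtx′ j → i ≡ j
vtx′-injective refl = refl

_≟ᴹ_ : ∀ {n} → DecidableEquality (MVert n)
vtx i ≟ᴹ vtx j = map′ (cong vtx) vtx-injective (i ≟ j)
vtx′ i ≟ᴹ vtx′ j = map′ (cong vtx′) vtx′-injective (i ≟ j)
uvtx ≟ᴹ uvtx = yes refl
vtx i ≟ᴹ vtx′ j = no λ ()
vtx i ≟ᴹ uvtx = no λ ()
vtx′ i ≟ᴹ vtx j = no λ ()
vtx′ i ≟ᴹ uvtx = no λ ()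
uvtx ≟ᴹ vtx j = no λ ()
uvtx ≟ᴹ vtx′ j = no λ ()

module OccMVert {n : ℕ} = Occurrences (_≟ᴹ_ {n})
open OccMVert public using () renaming (δ to δᴹ; occ to occᴹ)

sumMVert : ∀ n → (MVert n → ℕ) → ℕ
sumMVert n f = f uvtx + (sumFin n (λ i → f (vtx i)) + sumFin n (λ i → f (vtx′ i)))

sumMVert-cong : ∀ n {f g : MVert n → ℕ} → (∀ m → f m ≡ g m) → sumMVert n f ≡ sumMVert n g
sumMVert-cong n h = cong₂ _+_ (h uvtx) (cong₂ _+_ (sumFin-cong n (λ i → h (vtx i))) (sumFin-cong n (λ i → h (vtx′ i))))

sumMVert-+ : ∀ n (f g : MVert n → ℕ) → sumMVert n (λ m → f m + g m) ≡ sumMVert n f + sumMVert n g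
sumMVert-+ n f g rewrite sumFin-+ n (λ i → f (vtx i)) (λ i → g (vtx i)) | sumFin-+ n (λ i → f (vtx′ i)) (λ i → g (vtx′ i))
  = trans (cong (f uvtx + g uvtx +_) (interchange (sumFin n (λ i → f (vtx i))) _ _ _)) (interchange (f uvtx) (g uvtx) _ _)

sumMVert-zero : ∀ n {f : MVert n → ℕ} → (∀ m → f m ≡ 0) → sumMVert n f ≡ 0
sumMVert-zero n h rewrite h uvtx | sumFin-zero n (λ i → h (vtx i)) | sumFin-zero n (λ i → h (vtx′ i)) = refl

sumMVert-const : ∀ n k → sumMVert n (λ _ → k) ≡ (1 + (n + n)) * k
sumMVert-const n k rewrite sumFin-const n k = cong (k +_) (sym (*-distribʳ-+ k n n))

sumMVert-sumMap : ∀ {A : Set} n (f : MVert n → A → ℕ) ys →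
  sumMVert n (λ m → sumMap (f m) ys) ≡ sumMap (λ y → sumMVert n (λ m → f m y)) ys
sumMVert-sumMap n f [] = sumMVert-zero n (λ _ → refl)
sumMVert-sumMap n f (y ∷ ys) = trans (sumMVert-+ n (λ m → f m y) (λ m → sumMap (f m) ys))
  (cong (sumMVert n (λ m → f m y) +_) (sumMVert-sumMap n f ys))

sumMVert-δ : ∀ n (a : MVert n) → sumMVert n (λ m → δᴹ m a) ≡ 1
sumMVert-δ n (vtx i) rewrite sumFin-δ n i | sumFin-zero n {λ j → δᴹ (vtx′ j) (vtx i)} (λ _ → refl) = refl
sumMVert-δ n (vtx′ i) rewrite sumFin-δ n i | sumFin-zero n {λ j → δᴹ (vtx j) (vtx′ i)} (λ _ → refl) = refl
sumMVert-δ n uvtx rewrite sumFin-zero n {λ j → 0} (λ _ → refl) = refl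

sumMVert-occ : ∀ n (ys : List (MVert n)) → sumMVert n (λ m → occᴹ m ys) ≡ length ys
sumMVert-occ n ys = trans (sumMVert-sumMap n δᴹ ys) (trans (sumMap-cong ys (sumMVert-δ n)) (sumMap-one ys))

embed : ∀ {n} → MVert n → Fin (suc (n + n))
embed uvtx = zero
embed {n} (vtx i) = suc (i ↑ˡ n)
embed {n} (vtx′ i) = suc (n ↑ʳ i)

classify-embed : ∀ {n} (m : MVert n) → classify (embed m) ≡ m
classify-embed uvtx = refl
classify-embed {n} (vtx i) rewrite splitAt-↑ˡ n i n = refl
classify-embed {n} (vtx′ i) rewrite splitAt-↑ʳ n n i = refl

embed-classify : ∀ {n} (z : Fin (suc (n + n))) → embed (classify {n} z) ≡ z
embed-classify zero = refl
embed-classify {n} (suc k) with splitAt n k in eq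
... | inj₁ i = cong suc (splitAt⁻¹-↑ˡ eq)
... | inj₂ j = cong suc (splitAt⁻¹-↑ʳ eq)

classify-injective : ∀ {n} {z z′ : Fin (suc (n + n))} → classify {n} z ≡ classify z′ → z ≡ z′
classify-injective {z = z} {z′} eq = trans (sym (embed-classify z)) (trans (cong embed eq) (embed-classify z′))

embed-injective : ∀ {n} {m m′ : MVert n} → embed m ≡ embed m′ → m ≡ m′
embed-injective {m = m} {m′} eq = trans (sym (classify-embed m)) (trans (cong classify eq) (classify-embed m′))

complement⇒nonadjacent : ∀ {n} (A : Adj n) i j → complement A ⊢ i ~ j → i ≢ j × A i j ≡ false
complement⇒nonadjacent A i j h with A i j | i ≟ j
... | false | no i≢j = i≢j , refl

nonadjacent⇒complement : ∀ {n} (A : Adj n) i j → i ≢ j → A i j ≡ false → complement A ⊢ i ~ j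
nonadjacent⇒complement A i j i≢j Aij with i ≟ j
... | yes i≡j = ⊥-elim (i≢j i≡j)
... | no _ rewrite Aij = refl

complementGraph : ∀ {n} → Graph n → Graph n
complementGraph G = record
  { adj = complement (adj G)
  ; sym = λ i j → cong₂ (λ a b → not a ∧ not b) (Graph.sym G i j) (isYes-sym i j)
  ; irrefl = irrefl′
  }
  where
    irrefl′ : ∀ i → complement (adj G) i i ≡ false
    irrefl′ i with i ≟ i
    ... | yes _ = ∧-zeroʳ (not (adj G i i))
    ... | no i≢i = ⊥-elim (i≢i refl)
    isYes-sym : ∀ {n} (i j : Fin n) → ⌊ i ≟ j ⌋ ≡ ⌊ j ≟ i ⌋
    isYes-sym i j = trans (isYes≗does (i ≟ j)) (trans (does-sym i j) (sym (isYes≗does (j ≟ i))))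

-- 4-star matchings from edge lists of bounded degree

module StarForest {n : ℕ} (H : Graph n) where

  _~_ : Fin n → Fin n → Set
  i ~ j = adj H ⊢ i ~ j

  ~-sym : ∀ {i j} → i ~ j → j ~ i
  ~-sym {i} {j} h = trans (Graph.sym H j i) h

  ~⇒≢ : ∀ {i j} → i ~ j → i ≢ j
  ~⇒≢ {i} h refl with trans (sym (Graph.irrefl H i)) h
  ... | ()

  Edges : Set
  Edges = List (Fin n × Fin n)

  -- Opaque (as is `update` below), so that `with x ≟ a` in the proofs below does not reach inside.
  opaque
    deg : Fin n → Edges → ℕ
    deg x = sumMap (λ e → δ x (proj₁ e) + δ x (proj₂ e))

    deg-[] : ∀ x → deg x [] ≡ 0
    deg-[] x = refl

    deg-∷ : ∀ x a b E → deg x ((a , b) ∷ E) ≡ (δ x a + δ x b) + deg x E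
    deg-∷ x a b E = refl

    deg-++ : ∀ x E F → deg x (E ++ F) ≡ deg x E + deg x F
    deg-++ x = sumMap-++ _

  deg-concat : ∀ x Es → deg x (concat Es) ≡ sumMap (deg x) Es
  deg-concat x [] = deg-[] x
  deg-concat x (E ∷ Es) = trans (deg-++ x E (concat Es)) (cong (deg x E +_) (deg-concat x Es))

  deg-singleton : ∀ x a b → deg x ((a , b) ∷ []) ≡ δ x a + δ x b
  deg-singleton x a b = trans (deg-∷ x a b []) (trans (cong (δ x a + δ x b +_) (deg-[] x)) (+-identityʳ _))

  deg-other : ∀ {x a b} E → x ≢ a → x ≢ b → deg x ((a , b) ∷ E) ≡ deg x E
  deg-other {x} {a} {b} E x≢a x≢b rewrite deg-∷ x a b E | δ-≢ x≢a | δ-≢ x≢b = refl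

  deg-source : ∀ a b E → 1 ≤ deg a ((a , b) ∷ E)
  deg-source a b E rewrite deg-∷ a a b E | δ-refl a = s≤s z≤n

  deg-target : ∀ a b E → 1 + deg b E ≤ deg b ((a , b) ∷ E)
  deg-target a b E rewrite deg-∷ b a b E | δ-refl b = +-monoˡ-≤ (deg b E) (m≤n+m 1 (δ b a))

  deg-mono : ∀ x a b E → deg x E ≤ deg x ((a , b) ∷ E)
  deg-mono x a b E rewrite deg-∷ x a b E = m≤n+m _ _

  data Role : Set where
    unmatched central : Role
    leafOf : Fin n → Role

  leafOf-injective : ∀ {c d} → leafOf c ≡ leafOf d → c ≡ d
  leafOf-injective refl = refl

  isLeafOf : Role → Fin n → Bool
  isLeafOf (leafOf c) d = does (c ≟ d)
  isLeafOf _ d = false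

  isLeafOf-true : ∀ r c → isLeafOf r c ≡ true → r ≡ leafOf c
  isLeafOf-true (leafOf d) c h with d ≟ c
  ... | yes refl = refl

  isMatched : Role → Bool
  isMatched unmatched = false
  isMatched _ = true

  Roles : Set
  Roles = Fin n → Role

  leafCount : Roles → Fin n → ℕ
  leafCount R c = sumFin n (λ x → 𝟙 (isLeafOf (R x) c))

  record IsStarMatching (R : Roles) : Set where
    field
      leaf⇒central : ∀ x c → R x ≡ leafOf c → R c ≡ central
      leaf-adjacent : ∀ x c → R x ≡ leafOf c → c ~ x
      leafCount-bounds : ∀ c → R c ≡ central → 1 ≤ leafCount R c × leafCount R c ≤ 4
  open IsStarMatching public

  -- The last field keeps a star within four leaves when one more edge at its centre arrives.
  record Covers (E : Edges) (R : Roles) : Set where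
    field
      isolated⇒unmatched : ∀ x → deg x E ≡ 0 → R x ≡ unmatched
      unmatched⇒isolated : ∀ x → R x ≡ unmatched → deg x E ≡ 0
      leafCount≤deg : ∀ c → R c ≡ central → leafCount R c ≤ deg c E
  open Covers public

  opaque
    update : Roles → Fin n → Role → Roles
    update R a r x = if does (x ≟ a) then r else R x

    update-≡ : ∀ R a r → update R a r a ≡ r
    update-≡ R a r rewrite dec-true (a ≟ a) refl = refl

    update-≢ : ∀ R a r {x} → x ≢ a → update R a r x ≡ R x
    update-≢ R a r {x} x≢a rewrite dec-false (x ≟ a) x≢a = refl

  leafCount-update : ∀ R a r {r₀} d → R a ≡ r₀ →
    leafCount (update R a r) d + 𝟙 (isLeafOf r₀ d) ≡ leafCount R d + 𝟙 (isLeafOf r d)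
  leafCount-update R a r d refl =
    subst (λ r′ → leafCount (update R a r) d + 𝟙 (isLeafOf (R a) d) ≡ leafCount R d + 𝟙 (isLeafOf r′ d))
      (update-≡ R a r)
      (sumFin-update n (λ x → 𝟙 (isLeafOf (R x) d)) (λ x → 𝟙 (isLeafOf (update R a r x) d)) a
        (λ x x≢a → cong (λ r′ → 𝟙 (isLeafOf r′ d)) (update-≢ R a r x≢a)))

  leafCount-nonCentre : ∀ R → IsStarMatching R → ∀ b → R b ≢ central → leafCount R b ≡ 0
  leafCount-nonCentre R v b b≢central = sumFin-zero n noLeaf
    where
      noLeaf : ∀ x → 𝟙 (isLeafOf (R x) b) ≡ 0
      noLeaf x with isLeafOf (R x) b in eq
      ... | true = ⊥-elim (b≢central (leaf⇒central v x b (isLeafOf-true (R x) b eq)))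
      ... | false = refl

  -- b need not be covered, since this step also runs after `DetachLeaf`.
  module NewStar (a b : Fin n) (a~b : a ~ b) (E : Edges) (R : Roles) (v : IsStarMatching R)
     (Ra : R a ≡ unmatched) (Rb : R b ≡ unmatched)
     (isolated⇒unmatched′ : ∀ x → deg x E ≡ 0 → R x ≡ unmatched)
     (unmatched⇒isolated′ : ∀ x → x ≢ b → R x ≡ unmatched → deg x E ≡ 0)
     (leafCount≤deg′ : ∀ c → R c ≡ central → leafCount R c ≤ deg c E) where

    a≢b : a ≢ b
    a≢b = ~⇒≢ a~b

    R₁ R₂ : Roles
    R₁ = update R b central
    R₂ = update R₁ a (leafOf b)

    R₂a : R₂ a ≡ leafOf b
    R₂a = update-≡ R₁ a (leafOf b)

    R₂b : R₂ b ≡ central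
    R₂b = trans (update-≢ R₁ a (leafOf b) (≢-sym a≢b)) (update-≡ R b central)

    R₂-other : ∀ {x} → x ≢ a → x ≢ b → R₂ x ≡ R x
    R₂-other x≢a x≢b = trans (update-≢ R₁ a (leafOf b) x≢a) (update-≢ R b central x≢b)

    leafCount-R₂ : ∀ d → leafCount R₂ d ≡ leafCount R d + δ b d
    leafCount-R₂ d = begin
      leafCount R₂ d               ≡⟨ sym (+-identityʳ _) ⟩
      leafCount R₂ d + 0           ≡⟨ leafCount-update R₁ a (leafOf b) d (trans (update-≢ R b central a≢b) Ra) ⟩
      leafCount R₁ d + δ b d       ≡⟨ cong (_+ δ b d) (trans (sym (+-identityʳ _)) (leafCount-update R b central d Rb)) ⟩
      leafCount R d + 0 + δ b d    ≡⟨ cong (_+ δ b d) (+-identityʳ _) ⟩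
      leafCount R d + δ b d        ∎
      where open ≡-Reasoning

    leafCount-other : ∀ {d} → d ≢ b → leafCount R₂ d ≡ leafCount R d
    leafCount-other {d} d≢b = trans (leafCount-R₂ d) (trans (cong (leafCount R d +_) (δ-≢ (≢-sym d≢b))) (+-identityʳ _))

    leafCount-b : leafCount R₂ b ≡ 1
    leafCount-b = trans (leafCount-R₂ b)
      (cong₂ _+_ (leafCount-nonCentre R v b (λ Rb≡ → contradiction (trans (sym Rb) Rb≡) λ ())) (δ-refl b))

    isStarMatching : IsStarMatching R₂
    leaf⇒central isStarMatching x c eq with x ≟ a
    ... | yes refl = subst (λ z → R₂ z ≡ central) (leafOf-injective (trans (sym R₂a) eq)) R₂b
    ... | no x≢a with x ≟ b
    ...   | yes refl = contradiction (trans (sym eq) R₂b) λ ()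
    ...   | no x≢b with leaf⇒central v x c (trans (sym (R₂-other x≢a x≢b)) eq)
    ...     | Rc with c ≟ a
    ...       | yes refl = contradiction (trans (sym Rc) Ra) λ ()
    ...       | no c≢a with c ≟ b
    ...         | yes refl = R₂b
    ...         | no c≢b = trans (R₂-other c≢a c≢b) Rc
    leaf-adjacent isStarMatching x c eq with x ≟ a
    ... | yes refl = subst (_~ x) (leafOf-injective (trans (sym R₂a) eq)) (~-sym a~b)
    ... | no x≢a with x ≟ b
    ...   | yes refl = contradiction (trans (sym eq) R₂b) λ ()
    ...   | no x≢b = leaf-adjacent v x c (trans (sym (R₂-other x≢a x≢b)) eq)
    leafCount-bounds isStarMatching c eq with c ≟ b
    ... | yes refl = subst (λ k → 1 ≤ k × k ≤ 4) (sym leafCount-b) (s≤s z≤n , s≤s z≤n)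
    ... | no c≢b with c ≟ a
    ...   | yes refl = contradiction (trans (sym R₂a) eq) λ ()
    ...   | no c≢a = subst (λ k → 1 ≤ k × k ≤ 4) (sym (leafCount-other c≢b))
                       (leafCount-bounds v c (trans (sym (R₂-other c≢a c≢b)) eq))

    covering : Covers ((a , b) ∷ E) R₂
    isolated⇒unmatched covering x eq with x ≟ a
    ... | yes refl = contradiction (subst (1 ≤_) eq (deg-source a b E)) λ ()
    ... | no x≢a with x ≟ b
    ...   | yes refl = contradiction (subst (1 + deg b E ≤_) eq (deg-target a b E)) λ ()
    ...   | no x≢b = trans (R₂-other x≢a x≢b) (isolated⇒unmatched′ x (trans (sym (deg-other E x≢a x≢b)) eq))
    unmatched⇒isolated covering x eq with x ≟ a
    ... | yes refl = contradiction (trans (sym R₂a) eq) λ ()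
    ... | no x≢a with x ≟ b
    ...   | yes refl = contradiction (trans (sym R₂b) eq) λ ()
    ...   | no x≢b = trans (deg-other E x≢a x≢b) (unmatched⇒isolated′ x x≢b (trans (sym (R₂-other x≢a x≢b)) eq))
    leafCount≤deg covering c eq with c ≟ b
    ... | yes refl = subst (_≤ deg b ((a , b) ∷ E)) (sym leafCount-b) (≤-trans (s≤s z≤n) (deg-target a b E))
    ... | no c≢b with c ≟ a
    ...   | yes refl = contradiction (trans (sym R₂a) eq) λ ()
    ...   | no c≢a = subst (_≤ deg c ((a , b) ∷ E)) (sym (leafCount-other c≢b))
                       (≤-trans (leafCount≤deg′ c (trans (sym (R₂-other c≢a c≢b)) eq)) (deg-mono c a b E))

  module JoinStar (a b : Fin n) (a~b : a ~ b) (E : Edges) (R : Roles) (v : IsStarMatching R)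
     (cov : Covers E R) (Ra : R a ≡ unmatched) (Rb : R b ≡ central)
     (deg-b≤4 : deg b ((a , b) ∷ E) ≤ 4) where

    b≢a : b ≢ a
    b≢a = ≢-sym (~⇒≢ a~b)

    R₁ : Roles
    R₁ = update R a (leafOf b)

    R₁a : R₁ a ≡ leafOf b
    R₁a = update-≡ R a (leafOf b)

    R₁-other : ∀ {x} → x ≢ a → R₁ x ≡ R x
    R₁-other = update-≢ R a (leafOf b)

    R₁b : R₁ b ≡ central
    R₁b = trans (R₁-other b≢a) Rb

    leafCount-R₁ : ∀ d → leafCount R₁ d ≡ leafCount R d + δ b d
    leafCount-R₁ d = trans (sym (+-identityʳ _)) (leafCount-update R a (leafOf b) d Ra)

    leafCount-other : ∀ {d} → d ≢ b → leafCount R₁ d ≡ leafCount R d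
    leafCount-other {d} d≢b = trans (leafCount-R₁ d) (trans (cong (leafCount R d +_) (δ-≢ (≢-sym d≢b))) (+-identityʳ _))

    leafCount-b : leafCount R₁ b ≡ 1 + leafCount R b
    leafCount-b = trans (leafCount-R₁ b) (trans (cong (leafCount R b +_) (δ-refl b)) (+-comm _ 1))

    leafCount-b≤deg : leafCount R₁ b ≤ deg b ((a , b) ∷ E)
    leafCount-b≤deg = begin
      leafCount R₁ b          ≡⟨ leafCount-b ⟩
      1 + leafCount R b       ≤⟨ s≤s (leafCount≤deg cov b Rb) ⟩
      1 + deg b E             ≤⟨ deg-target a b E ⟩
      deg b ((a , b) ∷ E)     ∎
      where open ≤-Reasoning

    isStarMatching : IsStarMatching R₁
    leaf⇒central isStarMatching x d eq with x ≟ a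
    ... | yes refl = subst (λ z → R₁ z ≡ central) (leafOf-injective (trans (sym R₁a) eq)) R₁b
    ... | no x≢a with leaf⇒central v x d (trans (sym (R₁-other x≢a)) eq)
    ...   | Rd with d ≟ a
    ...     | yes refl = contradiction (trans (sym Rd) Ra) λ ()
    ...     | no d≢a = trans (R₁-other d≢a) Rd
    leaf-adjacent isStarMatching x d eq with x ≟ a
    ... | yes refl = subst (_~ x) (leafOf-injective (trans (sym R₁a) eq)) (~-sym a~b)
    ... | no x≢a = leaf-adjacent v x d (trans (sym (R₁-other x≢a)) eq)
    leafCount-bounds isStarMatching d eq with d ≟ b
    ... | yes refl = subst (1 ≤_) (sym leafCount-b) (s≤s z≤n) , ≤-trans leafCount-b≤deg deg-b≤4
    ... | no d≢b with d ≟ a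
    ...   | yes refl = contradiction (trans (sym R₁a) eq) λ ()
    ...   | no d≢a = subst (λ k → 1 ≤ k × k ≤ 4) (sym (leafCount-other d≢b))
                       (leafCount-bounds v d (trans (sym (R₁-other d≢a)) eq))

    covering : Covers ((a , b) ∷ E) R₁
    isolated⇒unmatched covering x eq with x ≟ a
    ... | yes refl = contradiction (subst (1 ≤_) eq (deg-source a b E)) λ ()
    ... | no x≢a with x ≟ b
    ...   | yes refl = contradiction (subst (1 + deg b E ≤_) eq (deg-target a b E)) λ ()
    ...   | no x≢b = trans (R₁-other x≢a) (isolated⇒unmatched cov x (trans (sym (deg-other E x≢a x≢b)) eq))
    unmatched⇒isolated covering x eq with x ≟ a
    ... | yes refl = contradiction (trans (sym R₁a) eq) λ ()
    ... | no x≢a with x ≟ b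
    ...   | yes refl = contradiction (trans (sym R₁b) eq) λ ()
    ...   | no x≢b = trans (deg-other E x≢a x≢b) (unmatched⇒isolated cov x (trans (sym (R₁-other x≢a)) eq))
    leafCount≤deg covering d eq with d ≟ b
    ... | yes refl = leafCount-b≤deg
    ... | no d≢b with d ≟ a
    ...   | yes refl = contradiction (trans (sym R₁a) eq) λ ()
    ...   | no d≢a = subst (_≤ deg d ((a , b) ∷ E)) (sym (leafCount-other d≢b))
                       (≤-trans (leafCount≤deg cov d (trans (sym (R₁-other d≢a)) eq)) (deg-mono d a b E))

  module DetachLeaf (b c : Fin n) (E : Edges) (R : Roles) (v : IsStarMatching R)
     (cov : Covers E R) (Rb : R b ≡ leafOf c) (two : 2 ≤ leafCount R c) where

    R₁ : Roles
    R₁ = update R b unmatched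

    R₁b : R₁ b ≡ unmatched
    R₁b = update-≡ R b unmatched

    R₁-other : ∀ {x} → x ≢ b → R₁ x ≡ R x
    R₁-other = update-≢ R b unmatched

    leafCount-R₁ : ∀ d → leafCount R₁ d + δ c d ≡ leafCount R d
    leafCount-R₁ d = trans (leafCount-update R b unmatched d Rb) (+-identityʳ _)

    leafCount-≤ : ∀ d → leafCount R₁ d ≤ leafCount R d
    leafCount-≤ d = subst (leafCount R₁ d ≤_) (leafCount-R₁ d) (m≤m+n _ _)

    leafCount-other : ∀ {d} → d ≢ c → leafCount R₁ d ≡ leafCount R d
    leafCount-other {d} d≢c = trans (sym (+-identityʳ _))
      (trans (cong (leafCount R₁ d +_) (sym (δ-≢ (≢-sym d≢c)))) (leafCount-R₁ d))

    leafCount-c : 1 ≤ leafCount R₁ c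
    leafCount-c = ≤-pred (subst (2 ≤_) (sym (trans (+-comm 1 _) (subst (λ k → leafCount R₁ c + k ≡ leafCount R c) (δ-refl c) (leafCount-R₁ c)))) two)

    isStarMatching : IsStarMatching R₁
    leaf⇒central isStarMatching x d eq with x ≟ b
    ... | yes refl = contradiction (trans (sym eq) R₁b) λ ()
    ... | no x≢b with leaf⇒central v x d (trans (sym (R₁-other x≢b)) eq)
    ...   | Rd with d ≟ b
    ...     | yes refl = contradiction (trans (sym Rb) Rd) λ ()
    ...     | no d≢b = trans (R₁-other d≢b) Rd
    leaf-adjacent isStarMatching x d eq with x ≟ b
    ... | yes refl = contradiction (trans (sym eq) R₁b) λ ()
    ... | no x≢b = leaf-adjacent v x d (trans (sym (R₁-other x≢b)) eq)
    leafCount-bounds isStarMatching d eq with d ≟ b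
    ... | yes refl = contradiction (trans (sym eq) R₁b) λ ()
    ... | no d≢b with leafCount-bounds v d (trans (sym (R₁-other d≢b)) eq)
    ...   | lo , hi with d ≟ c
    ...     | yes refl = leafCount-c , ≤-trans (leafCount-≤ d) hi
    ...     | no d≢c = subst (1 ≤_) (sym (leafCount-other d≢c)) lo , ≤-trans (leafCount-≤ d) hi

    isolated⇒unmatched₁ : ∀ x → deg x E ≡ 0 → R₁ x ≡ unmatched
    isolated⇒unmatched₁ x eq with x ≟ b
    ... | yes refl = R₁b
    ... | no x≢b = trans (R₁-other x≢b) (isolated⇒unmatched cov x eq)

    unmatched⇒isolated₁ : ∀ x → x ≢ b → R₁ x ≡ unmatched → deg x E ≡ 0
    unmatched⇒isolated₁ x x≢b eq = unmatched⇒isolated cov x (trans (sym (R₁-other x≢b)) eq)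

    leafCount≤deg₁ : ∀ d → R₁ d ≡ central → leafCount R₁ d ≤ deg d E
    leafCount≤deg₁ d eq with d ≟ b
    ... | yes refl = contradiction (trans (sym eq) R₁b) λ ()
    ... | no d≢b = ≤-trans (leafCount-≤ d) (leafCount≤deg cov d (trans (sym (R₁-other d≢b)) eq))

  module FlipStar (b c : Fin n) (E : Edges) (R : Roles) (v : IsStarMatching R)
     (cov : Covers E R) (Rb : R b ≡ leafOf c) (one : leafCount R c ≡ 1) where

    Rc : R c ≡ central
    Rc = leaf⇒central v b c Rb

    c≢b : c ≢ b
    c≢b refl = contradiction (trans (sym Rb) Rc) λ ()

    R₁ R₂ : Roles
    R₁ = update R b central
    R₂ = update R₁ c (leafOf b)

    R₂c : R₂ c ≡ leafOf b
    R₂c = update-≡ R₁ c (leafOf b)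

    R₂b : R₂ b ≡ central
    R₂b = trans (update-≢ R₁ c (leafOf b) (≢-sym c≢b)) (update-≡ R b central)

    R₂-other : ∀ {x} → x ≢ c → x ≢ b → R₂ x ≡ R x
    R₂-other x≢c x≢b = trans (update-≢ R₁ c (leafOf b) x≢c) (update-≢ R b central x≢b)

    leafCount-R₂ : ∀ d → leafCount R₂ d ≡ leafCount R₁ d + δ b d
    leafCount-R₂ d = trans (sym (+-identityʳ _)) (leafCount-update R₁ c (leafOf b) d (trans (update-≢ R b central c≢b) Rc))

    leafCount-R₁ : ∀ d → leafCount R₁ d + δ c d ≡ leafCount R d
    leafCount-R₁ d = trans (leafCount-update R b central d Rb) (+-identityʳ _)

    leafCount-other : ∀ {d} → d ≢ b → d ≢ c → leafCount R₂ d ≡ leafCount R d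
    leafCount-other {d} d≢b d≢c = begin
      leafCount R₂ d              ≡⟨ leafCount-R₂ d ⟩
      leafCount R₁ d + δ b d      ≡⟨ cong (leafCount R₁ d +_) (trans (δ-≢ (≢-sym d≢b)) (sym (δ-≢ (≢-sym d≢c)))) ⟩
      leafCount R₁ d + δ c d      ≡⟨ leafCount-R₁ d ⟩
      leafCount R d               ∎
      where open ≡-Reasoning

    leafCount-b : leafCount R₂ b ≡ 1
    leafCount-b = trans (leafCount-R₂ b) (cong₂ _+_ leafCount-R₁b (δ-refl b))
      where
        leafCount-R₁b : leafCount R₁ b ≡ 0
        leafCount-R₁b = m+n≡0⇒m≡0 _ (trans (leafCount-R₁ b) (leafCount-nonCentre R v b (λ Rb≡ → contradiction (trans (sym Rb) Rb≡) λ ())))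

    onlyLeaf : ∀ x → R x ≡ leafOf c → x ≡ b
    onlyLeaf x eq with x ≟ b
    ... | yes x≡b = x≡b
    ... | no x≢b = contradiction (subst (2 ≤_) one twoLeaves) λ { (s≤s ()) }
      where
        isLeaf : ∀ y → R y ≡ leafOf c → 𝟙 (isLeafOf (R y) c) ≡ 1
        isLeaf y eq′ rewrite eq′ | dec-true (c ≟ c) refl = refl
        twoLeaves : 2 ≤ leafCount R c
        twoLeaves = subst (_≤ leafCount R c) (cong₂ _+_ (isLeaf x eq) (isLeaf b Rb))
                      (sumFin-two n (λ y → 𝟙 (isLeafOf (R y) c)) x b x≢b)

    isStarMatching : IsStarMatching R₂
    leaf⇒central isStarMatching x d eq with x ≟ c
    ... | yes refl = subst (λ z → R₂ z ≡ central) (leafOf-injective (trans (sym R₂c) eq)) R₂b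
    ... | no x≢c with x ≟ b
    ...   | yes refl = contradiction (trans (sym eq) R₂b) λ ()
    ...   | no x≢b with leaf⇒central v x d (trans (sym (R₂-other x≢c x≢b)) eq)
    ...     | Rd with d ≟ b
    ...       | yes refl = contradiction (trans (sym Rb) Rd) λ ()
    ...       | no d≢b with d ≟ c
    ...         | yes refl = ⊥-elim (x≢b (onlyLeaf x (trans (sym (R₂-other x≢c x≢b)) eq)))
    ...         | no d≢c = trans (R₂-other d≢c d≢b) Rd
    leaf-adjacent isStarMatching x d eq with x ≟ c
    ... | yes refl = subst (_~ x) (leafOf-injective (trans (sym R₂c) eq)) (~-sym (leaf-adjacent v b x Rb))
    ... | no x≢c with x ≟ b
    ...   | yes refl = contradiction (trans (sym eq) R₂b) λ ()
    ...   | no x≢b = leaf-adjacent v x d (trans (sym (R₂-other x≢c x≢b)) eq)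
    leafCount-bounds isStarMatching d eq with d ≟ b
    ... | yes refl = subst (λ k → 1 ≤ k × k ≤ 4) (sym leafCount-b) (s≤s z≤n , s≤s z≤n)
    ... | no d≢b with d ≟ c
    ...   | yes refl = contradiction (trans (sym R₂c) eq) λ ()
    ...   | no d≢c = subst (λ k → 1 ≤ k × k ≤ 4) (sym (leafCount-other d≢b d≢c))
                       (leafCount-bounds v d (trans (sym (R₂-other d≢c d≢b)) eq))

    matched⇒deg>0 : ∀ x → R x ≢ unmatched → 1 ≤ deg x E
    matched⇒deg>0 x Rx≢ with deg x E in eq
    ... | zero = ⊥-elim (Rx≢ (isolated⇒unmatched cov x eq))
    ... | suc _ = s≤s z≤n

    covering : Covers E R₂
    isolated⇒unmatched covering x eq with x ≟ c
    ... | yes refl = contradiction (trans (sym Rc) (isolated⇒unmatched cov x eq)) λ ()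
    ... | no x≢c with x ≟ b
    ...   | yes refl = contradiction (trans (sym Rb) (isolated⇒unmatched cov x eq)) λ ()
    ...   | no x≢b = trans (R₂-other x≢c x≢b) (isolated⇒unmatched cov x eq)
    unmatched⇒isolated covering x eq with x ≟ c
    ... | yes refl = contradiction (trans (sym R₂c) eq) λ ()
    ... | no x≢c with x ≟ b
    ...   | yes refl = contradiction (trans (sym R₂b) eq) λ ()
    ...   | no x≢b = unmatched⇒isolated cov x (trans (sym (R₂-other x≢c x≢b)) eq)
    leafCount≤deg covering d eq with d ≟ b
    ... | yes refl = subst (_≤ deg d E) (sym leafCount-b) (matched⇒deg>0 d (λ Rd → contradiction (trans (sym Rb) Rd) λ ()))
    ... | no d≢b with d ≟ c
    ...   | yes refl = contradiction (trans (sym R₂c) eq) λ ()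
    ...   | no d≢c = subst (_≤ deg d E) (sym (leafCount-other d≢b d≢c)) (leafCount≤deg cov d (trans (sym (R₂-other d≢c d≢b)) eq))

  StarRoles : Edges → Set
  StarRoles E = Σ Roles (λ R → IsStarMatching R × Covers E R)

  extendAtIsolated : ∀ a b → a ~ b → ∀ E → ((R , _) : StarRoles E) → deg a E ≡ 0 →
    (∀ x → deg x ((a , b) ∷ E) ≤ 4) → StarRoles ((a , b) ∷ E)
  extendAtIsolated a b a~b E (R , v , cov) a-isolated deg≤4 = byRoleOf-b (R b) refl
    where
      Ra : R a ≡ unmatched
      Ra = isolated⇒unmatched cov a a-isolated

      byRoleOf-b : ∀ r → R b ≡ r → StarRoles ((a , b) ∷ E)
      byRoleOf-b unmatched Rb =
        let module S = NewStar a b a~b E R v Ra Rb (isolated⇒unmatched cov) (λ x _ → unmatched⇒isolated cov x) (leafCount≤deg cov)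
        in S.R₂ , S.isStarMatching , S.covering
      byRoleOf-b central Rb =
        let module S = JoinStar a b a~b E R v cov Ra Rb (deg≤4 b) in S.R₁ , S.isStarMatching , S.covering
      byRoleOf-b (leafOf c) Rb with leafCount R c in count | leafCount-bounds v c (leaf⇒central v b c Rb)
      ... | suc zero | _ =
        let module F = FlipStar b c E R v cov Rb count
            a≢c : a ≢ c
            a≢c a≡c = contradiction (trans (sym F.Rc) (trans (cong R (sym a≡c)) Ra)) λ ()
            module S = JoinStar a b a~b E F.R₂ F.isStarMatching F.covering (trans (F.R₂-other a≢c (~⇒≢ a~b)) Ra) F.R₂b (deg≤4 b)
        in S.R₁ , S.isStarMatching , S.covering
      ... | suc (suc _) | _ =
        let module D = DetachLeaf b c E R v cov Rb (subst (2 ≤_) (sym count) (s≤s (s≤s z≤n)))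
            module S = NewStar a b a~b E D.R₁ D.isStarMatching (trans (D.R₁-other (~⇒≢ a~b)) Ra) D.R₁b
                         D.isolated⇒unmatched₁ D.unmatched⇒isolated₁ D.leafCount≤deg₁
        in S.R₂ , S.isStarMatching , S.covering

  starRoles : ∀ E → All (λ (a , b) → a ~ b) E → (∀ x → deg x E ≤ 4) → StarRoles E
  starRoles [] _ _ = (λ _ → unmatched) , none , noEdges
    where
      none : IsStarMatching (λ _ → unmatched)
      leaf⇒central none x c ()
      leaf-adjacent none x c ()
      leafCount-bounds none c ()
      noEdges : Covers [] (λ _ → unmatched)
      isolated⇒unmatched noEdges x _ = refl
      unmatched⇒isolated noEdges x _ = deg-[] x
      leafCount≤deg noEdges c ()
  starRoles ((a , b) ∷ E) (a~b ∷ edges) deg≤4 = extend (starRoles E edges (λ x → ≤-trans (deg-mono x a b E) (deg≤4 x)))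
    where
      swapped : ∀ x → deg x ((a , b) ∷ E) ≡ deg x ((b , a) ∷ E)
      swapped x rewrite deg-∷ x a b E | deg-∷ x b a E = cong (_+ deg x E) (+-comm (δ x a) (δ x b))

      extend : StarRoles E → StarRoles ((a , b) ∷ E)
      extend (R , v , cov) with deg a E in deg-a | deg b E in deg-b
      ... | zero | _ = extendAtIsolated a b a~b E (R , v , cov) deg-a deg≤4
      ... | suc _ | zero with extendAtIsolated b a (~-sym a~b) E (R , v , cov) deg-b (λ x → subst (_≤ 4) (swapped x) (deg≤4 x))
      ...   | R′ , v′ , cov′ = R′ , v′ , record
              { isolated⇒unmatched = λ x eq → isolated⇒unmatched cov′ x (trans (sym (swapped x)) eq)
              ; unmatched⇒isolated = λ x eq → trans (swapped x) (unmatched⇒isolated cov′ x eq)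
              ; leafCount≤deg = λ c eq → subst (leafCount R′ c ≤_) (sym (swapped c)) (leafCount≤deg cov′ c eq) }
      extend (R , v , cov) | suc _ | suc _ = R , v , record
        { isolated⇒unmatched = λ x eq → isolated⇒unmatched cov x (n≤0⇒n≡0 (subst (deg x E ≤_) eq (deg-mono x a b E)))
        ; unmatched⇒isolated = unmatched⇒isolated′
        ; leafCount≤deg = λ c eq → ≤-trans (leafCount≤deg cov c eq) (deg-mono c a b E) }
        where
          unmatched⇒isolated′ : ∀ x → R x ≡ unmatched → deg x ((a , b) ∷ E) ≡ 0
          unmatched⇒isolated′ x eq with x ≟ a | x ≟ b
          ... | yes refl | _ = contradiction (trans (sym deg-a) (unmatched⇒isolated cov x eq)) λ ()
          ... | no _ | yes refl = contradiction (trans (sym deg-b) (unmatched⇒isolated cov x eq)) λ ()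
          ... | no x≢a | no x≢b = trans (deg-other E x≢a x≢b) (unmatched⇒isolated cov x eq)

  isCentral : Role → Bool
  isCentral central = true
  isCentral _ = false

  leavesOf : Roles → Fin n → List (Fin n)
  leavesOf R c = filterᵇ (λ x → isLeafOf (R x) c) (allFin n)

  length-leavesOf : ∀ R c → length (leavesOf R c) ≡ leafCount R c
  length-leavesOf R c = trans (sym (sumFin-occ n (leavesOf R c))) (sumFin-cong n (occ-filterᵇ-allFin _))

  starAt : ∀ R → IsStarMatching R → ∀ c → R c ≡ central → Star4 (adj H)
  starAt R v c Rc = record
    { centre = c
    ; leaves = leavesOf R c
    ; nonempty = subst (1 ≤_) (sym (length-leavesOf R c)) (proj₁ (leafCount-bounds v c Rc))
    ; atmost4 = subst (_≤ 4) (sym (length-leavesOf R c)) (proj₂ (leafCount-bounds v c Rc))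
    ; adjacent = All.tabulate λ {x} x∈ →
        leaf-adjacent v x c (isLeafOf-true (R x) c (Equivalence.to T-≡ (proj₂ (∈-filter⁻ (T? ∘ (λ y → isLeafOf (R y) c)) {xs = allFin n} x∈))))
    }

  starsAt : ∀ R → IsStarMatching R → ∀ c r → R c ≡ r → List (Star4 (adj H))
  starsAt R v c central Rc = starAt R v c Rc ∷ []
  starsAt R v c _ _ = []

  occ-starsAt : ∀ R v x c r (Rc : R c ≡ r) → sumMap (λ s → occ x (starVertices s)) (starsAt R v c r Rc)
                                              ≡ 𝟙 (isCentral r) * (δ x c + 𝟙 (isLeafOf (R x) c))
  occ-starsAt R v x c central Rc = cong₂ _+_ (cong (δ x c +_) (occ-filterᵇ-allFin _ x)) refl
  occ-starsAt R v x c unmatched Rc = refl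
  occ-starsAt R v x c (leafOf _) Rc = refl

  isLeaf : Role → Bool
  isLeaf (leafOf _) = true
  isLeaf _ = false

  occ-stars : ∀ R → IsStarMatching R → ∀ x →
    sumFin n (λ c → 𝟙 (isCentral (R c)) * (δ x c + 𝟙 (isLeafOf (R x) c))) ≡ 𝟙 (isMatched (R x))
  occ-stars R v x = begin
    sumFin n (λ c → 𝟙 (isCentral (R c)) * (δ x c + 𝟙 (isLeafOf (R x) c)))
      ≡⟨ sumFin-cong n (λ c → *-distribˡ-+ (𝟙 (isCentral (R c))) _ _) ⟩
    sumFin n (λ c → 𝟙 (isCentral (R c)) * δ x c + 𝟙 (isCentral (R c)) * 𝟙 (isLeafOf (R x) c))
      ≡⟨ sumFin-+ n _ _ ⟩
    sumFin n (λ c → 𝟙 (isCentral (R c)) * δ x c) + sumFin n (λ c → 𝟙 (isCentral (R c)) * 𝟙 (isLeafOf (R x) c))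
      ≡⟨ cong₂ _+_ asCentre (asLeaf (R x) refl) ⟩
    𝟙 (isCentral (R x)) + 𝟙 (isLeaf (R x))
      ≡⟨ byRole (R x) ⟩
    𝟙 (isMatched (R x)) ∎
    where
      open ≡-Reasoning
      asCentre : sumFin n (λ c → 𝟙 (isCentral (R c)) * δ x c) ≡ 𝟙 (isCentral (R x))
      asCentre = trans (sumFin-single n _ x (λ c c≢x → trans (cong (𝟙 (isCentral (R c)) *_) (δ-≢ (≢-sym c≢x))) (*-zeroʳ (𝟙 (isCentral (R c))))))
                       (trans (cong (𝟙 (isCentral (R x)) *_) (δ-refl x)) (*-identityʳ _))
      asLeaf : ∀ r → R x ≡ r → sumFin n (λ c → 𝟙 (isCentral (R c)) * 𝟙 (isLeafOf r c)) ≡ 𝟙 (isLeaf r)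
      asLeaf unmatched _ = sumFin-zero n (λ c → *-zeroʳ (𝟙 (isCentral (R c))))
      asLeaf central _ = sumFin-zero n (λ c → *-zeroʳ (𝟙 (isCentral (R c))))
      asLeaf (leafOf d) Rx = trans (sumFin-single n _ d notD) atD
        where
          notD : ∀ c → c ≢ d → 𝟙 (isCentral (R c)) * δ d c ≡ 0
          notD c c≢d = trans (cong (𝟙 (isCentral (R c)) *_) (δ-≢ (≢-sym c≢d))) (*-zeroʳ (𝟙 (isCentral (R c))))
          atD : 𝟙 (isCentral (R d)) * δ d d ≡ 1
          atD rewrite leaf⇒central v x d Rx | δ-refl d = refl
      byRole : ∀ r → 𝟙 (isCentral r) + 𝟙 (isLeaf r) ≡ 𝟙 (isMatched r)
      byRole unmatched = refl
      byRole central = refl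
      byRole (leafOf _) = refl

  starMatchingOf : ∀ R → IsStarMatching R → Σ (StarMatching (adj H)) (λ M → smSize M ≡ sumFin n (λ x → 𝟙 (isMatched (R x))))
  starMatchingOf R v = record { stars = stars′ ; disjoint = OccFin.occ≤1⇒Unique (concat (map starVertices stars′)) occ≤1 } , size
    where
      stars′ : List (Star4 (adj H))
      stars′ = concat (map (λ c → starsAt R v c (R c) refl) (allFin n))
      occ-vertices : ∀ x → occ x (concat (map starVertices stars′)) ≡ 𝟙 (isMatched (R x))
      occ-vertices x = begin
        occ x (concat (map starVertices stars′))
          ≡⟨ trans (OccFin.occ-concat x (map starVertices stars′)) (sumMap-map (occ x) starVertices stars′) ⟩
        sumMap (λ s → occ x (starVertices s)) stars′
          ≡⟨ trans (sumMap-concat _ (map (λ c → starsAt R v c (R c) refl) (allFin n))) (sumMap-map _ (λ c → starsAt R v c (R c) refl) (allFin n)) ⟩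
        sumMap (λ c → sumMap (λ s → occ x (starVertices s)) (starsAt R v c (R c) refl)) (allFin n)
          ≡⟨ trans (sumMap-allFin n _) (sumFin-cong n (λ c → occ-starsAt R v x c (R c) refl)) ⟩
        sumFin n (λ c → 𝟙 (isCentral (R c)) * (δ x c + 𝟙 (isLeafOf (R x) c)))
          ≡⟨ occ-stars R v x ⟩
        𝟙 (isMatched (R x)) ∎
        where open ≡-Reasoning
      occ≤1 : ∀ x → occ x (concat (map starVertices stars′)) ≤ 1
      occ≤1 x = subst (_≤ 1) (sym (occ-vertices x)) (𝟙≤1 _)
      size : length (concat (map starVertices stars′)) ≡ sumFin n (λ x → 𝟙 (isMatched (R x)))
      size = trans (sym (sumFin-occ n (concat (map starVertices stars′)))) (sumFin-cong n occ-vertices)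

  starMatching-covering : ∀ E → All (λ (a , b) → a ~ b) E → (∀ x → deg x E ≤ 4) →
    Σ (StarMatching (adj H)) (λ M → n ≤ smSize M + sumFin n (λ x → 𝟙 (deg x E ≡ᵇ 0)))
  starMatching-covering E edges deg≤4 with starRoles E edges deg≤4
  ... | R , v , cov with starMatchingOf R v
  ...   | M , size = M , subst (λ k → n ≤ k + sumFin n (λ x → 𝟙 (deg x E ≡ᵇ 0))) (sym size) everyVertex
    where
      matchedOrIsolated : ∀ x → 1 ≤ 𝟙 (isMatched (R x)) + 𝟙 (deg x E ≡ᵇ 0)
      matchedOrIsolated x with deg x E in eq
      ... | zero = m≤n+m 1 _
      ... | suc _ with R x in Rx
      ...   | unmatched = contradiction (trans (sym eq) (unmatched⇒isolated cov x Rx)) λ ()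
      ...   | central = s≤s z≤n
      ...   | leafOf _ = s≤s z≤n
      everyVertex : n ≤ sumFin n (λ x → 𝟙 (isMatched (R x))) + sumFin n (λ x → 𝟙 (deg x E ≡ᵇ 0))
      everyVertex = subst₂ _≤_ (trans (sumFin-const n 1) (*-identityʳ n)) (sumFin-+ n _ _) (sumFin-mono n matchedOrIsolated)

-- Path covers of the complement of M(G)

CoAdj : ∀ {n} → Adj n → MVert n → MVert n → Set
CoAdj A m m′ = m ≢ m′ × mycAdj A m m′ ≡ false

complementMyc⇒CoAdj : ∀ {n} (A : Adj n) {z z′} → complement (mycielski A) ⊢ z ~ z′ → CoAdj A (classify z) (classify z′)
complementMyc⇒CoAdj A {z} {z′} h with complement⇒nonadjacent (mycielski A) z z′ h
... | z≢z′ , nonadj = (λ eq → z≢z′ (classify-injective eq)) , nonadj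

CoAdj⇒complementMyc : ∀ {n} (A : Adj n) {m m′} → CoAdj A m m′ → complement (mycielski A) ⊢ embed m ~ embed m′
CoAdj⇒complementMyc A {m} {m′} (m≢m′ , nonadj) =
  nonadjacent⇒complement (mycielski A) (embed m) (embed m′) (λ eq → m≢m′ (embed-injective eq))
    (trans (cong₂ (mycAdj A) (classify-embed m) (classify-embed m′)) nonadj)

-- A path cover of the complement of M(G), read through `classify`.
record MPathCover {n} (A : Adj n) : Set where
  field
    mpaths : List (List (MVert n))
    mnonempty : All (λ p → 1 ≤ length p) mpaths
    mlinked : All (Linked (CoAdj A)) mpaths
    partition : ∀ m → occᴹ m (concat mpaths) ≡ 1
open MPathCover public

module _ {n} (A : Adj n) where

  private
    K : Adj (suc (n + n))
    K = complement (mycielski A)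

  toPaths : (pss : List (List (MVert n))) → All (λ p → 1 ≤ length p) pss → All (Linked (CoAdj A)) pss → List (Path K)
  toPaths [] [] [] = []
  toPaths (ps ∷ pss) (ne ∷ nes) (l ∷ ls) =
    record { verts = map embed ps
           ; nonempty = subst (1 ≤_) (sym (length-map embed ps)) ne
           ; linked = Linkedₚ.map⁺ (Linked.map (λ {m} {m′} → CoAdj⇒complementMyc A {m} {m′}) l) }
    ∷ toPaths pss nes ls

  toPaths-verts : ∀ pss nes ls → concat (map verts (toPaths pss nes ls)) ≡ map embed (concat pss)
  toPaths-verts [] [] [] = refl
  toPaths-verts (ps ∷ pss) (ne ∷ nes) (l ∷ ls) =
    trans (cong (map embed ps ++_) (toPaths-verts pss nes ls)) (sym (map-++ embed ps (concat pss)))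

  toPaths-length : ∀ pss nes ls → length (toPaths pss nes ls) ≡ length pss
  toPaths-length [] [] [] = refl
  toPaths-length (ps ∷ pss) (ne ∷ nes) (l ∷ ls) = cong suc (toPaths-length pss nes ls)

  toPathCover : (C : MPathCover A) → Σ (PathCover K) (λ C′ → length (paths C′) ≡ length (mpaths C))
  toPathCover C = record { paths = P ; disjoint = disjoint′ ; covers = covers′ } , toPaths-length (mpaths C) (mnonempty C) (mlinked C)
    where
      P = toPaths (mpaths C) (mnonempty C) (mlinked C)
      disjoint′ : Unique (concat (map verts P))
      disjoint′ = subst Unique (sym (toPaths-verts (mpaths C) (mnonempty C) (mlinked C)))
        (Uniqueₚ.map⁺ embed-injective (OccMVert.occ≤1⇒Unique _ (λ m → ≤-reflexive (partition C m))))
      covers′ : ∀ z → z ∈ concat (map verts P)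
      covers′ z = subst (z ∈_) (sym (toPaths-verts (mpaths C) (mnonempty C) (mlinked C)))
        (subst (_∈ map embed (concat (mpaths C))) (embed-classify z)
          (∈-map⁺ embed (OccMVert.occ⇒∈ (classify z) _ (≤-reflexive (sym (partition C (classify z)))))))

  fromPath : Path K → List (MVert n)
  fromPath P = map classify (verts P)

  fromPath-nonempty : ∀ P → 1 ≤ length (fromPath P)
  fromPath-nonempty P = subst (1 ≤_) (sym (length-map (classify {n}) (verts P))) (nonempty P)

  fromPath-linked : ∀ P → Linked (CoAdj A) (fromPath P)
  fromPath-linked P = Linkedₚ.map⁺ (Linked.map (λ {z} {z′} → complementMyc⇒CoAdj A {z} {z′}) (linked P))

  concat-fromPath : ∀ (ps : List (Path K)) → concat (map fromPath ps) ≡ map classify (concat (map verts ps))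
  concat-fromPath [] = refl
  concat-fromPath (P ∷ ps) = trans (cong (fromPath P ++_) (concat-fromPath ps)) (sym (map-++ classify (verts P) _))

  fromPathCover : (C : PathCover K) → Σ (MPathCover A) (λ C′ → length (mpaths C′) ≡ length (paths C))
  fromPathCover C = record
    { mpaths = map fromPath (paths C)
    ; mnonempty = Allₚ.map⁺ (All.tabulate (λ {P} _ → fromPath-nonempty P))
    ; mlinked = Allₚ.map⁺ (All.tabulate (λ {P} _ → fromPath-linked P))
    ; partition = partition′
    } , length-map fromPath (paths C)
    where
      L = concat (map verts (paths C))
      unique : Unique (map classify L)
      unique = Uniqueₚ.map⁺ classify-injective (disjoint C)
      partition′ : ∀ m → occᴹ m (concat (map fromPath (paths C))) ≡ 1
      partition′ m rewrite concat-fromPath (paths C) = ≤-antisym (OccMVert.Unique⇒occ≤1 unique m)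
        (OccMVert.∈⇒occ (subst (_∈ map classify L) (classify-embed m) (∈-map⁺ classify (covers C (embed m)))))

-- The lower bound i₄ ≤ 2 p_v + 2

edgesOf : ∀ {X : Set} → List X → List (X × X)
edgesOf [] = []
edgesOf (x ∷ []) = []
edgesOf (x ∷ y ∷ ys) = (x , y) ∷ edgesOf (y ∷ ys)

length-edgesOf : ∀ {X : Set} (y : X) ys → length (edgesOf (y ∷ ys)) ≡ length ys
length-edgesOf y [] = refl
length-edgesOf y (z ∷ zs) = cong suc (length-edgesOf z zs)

edgesOf-linked : ∀ {X : Set} {R : X → X → Set} {xs} → Linked R xs → All (λ e → R (proj₁ e) (proj₂ e)) (edgesOf xs)
edgesOf-linked [] = []
edgesOf-linked [-] = []
edgesOf-linked (r ∷ l) = r ∷ edgesOf-linked l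

length-edgesOf-concat : ∀ {X : Set} (xss : List (List X)) → All (λ xs → 1 ≤ length xs) xss →
  length (concat (map edgesOf xss)) + length xss ≡ length (concat xss)
length-edgesOf-concat [] [] = refl
length-edgesOf-concat ((y ∷ ys) ∷ xss) (_ ∷ nes) = begin
  length (edgesOf (y ∷ ys) ++ concat (map edgesOf xss)) + suc (length xss)
    ≡⟨ cong (_+ suc (length xss)) (length-++ (edgesOf (y ∷ ys))) ⟩
  length (edgesOf (y ∷ ys)) + length (concat (map edgesOf xss)) + suc (length xss)
    ≡⟨ cong (λ k → k + length (concat (map edgesOf xss)) + suc (length xss)) (length-edgesOf y ys) ⟩
  length ys + length (concat (map edgesOf xss)) + suc (length xss)
    ≡⟨ reassoc (length ys) (length (concat (map edgesOf xss))) (length xss) ⟩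
  suc (length ys + (length (concat (map edgesOf xss)) + length xss))
    ≡⟨ cong (λ k → suc (length ys + k)) (length-edgesOf-concat xss nes) ⟩
  suc (length ys + length (concat xss))
    ≡⟨ cong suc (sym (length-++ ys)) ⟩
  length ((y ∷ ys) ++ concat xss) ∎
  where
    open ≡-Reasoning
    reassoc : ∀ a b c → a + b + suc c ≡ suc (a + (b + c))
    reassoc = solve-∀

module PathEdges {n : ℕ} where

  Edge : Set
  Edge = MVert n × MVert n

  incid : MVert n → Edge → ℕ
  incid m e = δᴹ m (proj₁ e) + δᴹ m (proj₂ e)

  incid-edgesOf≤ : ∀ m xs → sumMap (incid m) (edgesOf xs) ≤ 2 * occᴹ m xs
  incid-edgesOf≤ m [] = z≤n
  incid-edgesOf≤ m (y ∷ ys) = ≤-trans (m≤m+n _ (δᴹ m y)) (go y ys)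
    where
      go : ∀ y ys → sumMap (incid m) (edgesOf (y ∷ ys)) + δᴹ m y ≤ 2 * occᴹ m (y ∷ ys)
      go y [] = subst (δᴹ m y ≤_) (sym (double (δᴹ m y))) (m≤m+n (δᴹ m y) _)
        where
          double : ∀ a → 2 * (a + 0) ≡ a + a
          double = solve-∀
      go y (z ∷ zs) = subst₂ _≤_ (sym (lhs (δᴹ m y) (δᴹ m z) (sumMap (incid m) (edgesOf (z ∷ zs)))))
                                  (sym (rhs (δᴹ m y) (δᴹ m z) (occᴹ m zs)))
                        (+-monoʳ-≤ (2 * δᴹ m y) (go z zs))
        where
          lhs : ∀ a b s → (a + b) + s + a ≡ 2 * a + (s + b)
          lhs = solve-∀
          rhs : ∀ a b c → 2 * (a + (b + c)) ≡ 2 * a + 2 * (b + c)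
          rhs = solve-∀

  absent⇒no-incid : ∀ m xs → occᴹ m xs ≡ 0 → sumMap (incid m) (edgesOf xs) ≡ 0
  absent⇒no-incid m xs absent = n≤0⇒n≡0 (subst (λ k → sumMap (incid m) (edgesOf xs) ≤ 2 * k) absent (incid-edgesOf≤ m xs))

  joins : MVert n → MVert n → Edge → ℕ
  joins m m′ e = 𝟙 (does (m ≟ᴹ proj₁ e) ∧ does (m′ ≟ᴹ proj₂ e)) + 𝟙 (does (m′ ≟ᴹ proj₁ e) ∧ does (m ≟ᴹ proj₂ e))

  joins≤incidˡ : ∀ m m′ e → joins m m′ e ≤ incid m e
  joins≤incidˡ m m′ (a , b) = +-mono-≤ (𝟙-∧ˡ (does (m ≟ᴹ a)) _) (𝟙-∧ʳ (does (m′ ≟ᴹ a)) _)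

  joins≤incidʳ : ∀ m m′ e → joins m m′ e ≤ incid m′ e
  joins≤incidʳ m m′ (a , b) = subst (joins m m′ (a , b) ≤_) (+-comm (δᴹ m′ b) (δᴹ m′ a))
    (+-mono-≤ (𝟙-∧ʳ (does (m ≟ᴹ a)) _) (𝟙-∧ˡ (does (m′ ≟ᴹ a)) _))

  absent⇒no-joins : ∀ m m′ xs → occᴹ m xs ≡ 0 ⊎ occᴹ m′ xs ≡ 0 → sumMap (joins m m′) (edgesOf xs) ≡ 0
  absent⇒no-joins m m′ xs (inj₁ absent) =
    n≤0⇒n≡0 (subst (sumMap (joins m m′) (edgesOf xs) ≤_) (absent⇒no-incid m xs absent) (sumMap-mono (edgesOf xs) (joins≤incidˡ m m′)))
  absent⇒no-joins m m′ xs (inj₂ absent) =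
    n≤0⇒n≡0 (subst (sumMap (joins m m′) (edgesOf xs) ≤_) (absent⇒no-incid m′ xs absent) (sumMap-mono (edgesOf xs) (joins≤incidʳ m m′)))

  joins-edgesOf≤ : ∀ {m m′} → m ≢ m′ → ∀ xs → occᴹ m xs ≤ 1 → occᴹ m′ xs ≤ 1 →
    sumMap (joins m m′) (edgesOf xs) ≤ occᴹ m xs
  joins-edgesOf≤ m≢m′ [] _ _ = z≤n
  joins-edgesOf≤ m≢m′ (y ∷ []) _ _ = z≤n
  joins-edgesOf≤ {m} {m′} m≢m′ (y ∷ z ∷ zs) once once′ =
    step (joins-edgesOf≤ m≢m′ (z ∷ zs) (≤-trans (m≤n+m _ (δᴹ m y)) once) (≤-trans (m≤n+m _ (δᴹ m′ y)) once′))
    where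
      step : sumMap (joins m m′) (edgesOf (z ∷ zs)) ≤ occᴹ m (z ∷ zs) →
             sumMap (joins m m′) (edgesOf (y ∷ z ∷ zs)) ≤ occᴹ m (y ∷ z ∷ zs)
      step ih with m ≟ᴹ y | m′ ≟ᴹ y
      ... | yes refl | yes m′≡m = ⊥-elim (m≢m′ (sym m′≡m))
      ... | yes refl | no _ rewrite absent⇒no-joins m m′ (z ∷ zs) (inj₁ (n≤0⇒n≡0 (≤-pred once))) =
        ≤-trans (≤-reflexive (trans (+-identityʳ _) (+-identityʳ _))) (≤-trans (𝟙≤1 _) (m≤m+n 1 _))
      ... | no _ | yes refl rewrite absent⇒no-joins m m′ (z ∷ zs) (inj₂ (n≤0⇒n≡0 (≤-pred once′))) =
        +-monoʳ-≤ (δᴹ m z) z≤n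
      ... | no _ | no _ = ih

  joins-concat≤ : ∀ {m m′} → m ≢ m′ → ∀ pss → (∀ k → occᴹ k (concat pss) ≤ 1) →
    sumMap (λ ps → sumMap (joins m m′) (edgesOf ps)) pss ≤ occᴹ m (concat pss)
  joins-concat≤ m≢m′ [] _ = z≤n
  joins-concat≤ {m} {m′} m≢m′ (ps ∷ pss) once =
    subst (sumMap (λ ps → sumMap (joins m m′) (edgesOf ps)) (ps ∷ pss) ≤_) (sym (OccMVert.occ-++ m ps (concat pss)))
      (+-mono-≤ (joins-edgesOf≤ m≢m′ ps (inHead m) (inHead m′)) (joins-concat≤ m≢m′ pss inTail))
    where
      inHead : ∀ k → occᴹ k ps ≤ 1
      inHead k = ≤-trans (OccMVert.occ-++ˡ k ps (concat pss)) (once k)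
      inTail : ∀ k → occᴹ k (concat pss) ≤ 1
      inTail k = ≤-trans (OccMVert.occ-++ʳ k ps (concat pss)) (once k)

module Projection {n : ℕ} (G : Graph n) where
  open PathEdges {n}
  open StarForest (complementGraph G) using (_~_; deg; deg-[]; deg-singleton)

  projectEdge : MVert n → MVert n → List (Fin n × Fin n)
  projectEdge (vtx i) (vtx j) = (i , j) ∷ []
  projectEdge (vtx i) (vtx′ j) = if does (i ≟ j) then [] else (i , j) ∷ []
  projectEdge (vtx′ i) (vtx j) = if does (i ≟ j) then [] else (i , j) ∷ []
  projectEdge _ _ = []

  uEdge : Fin n → MVert n → MVert n → ℕ
  uEdge x (vtx i) uvtx = δ x i
  uEdge x uvtx (vtx j) = δ x j
  uEdge x _ _ = 0

  projectEdge-adjacent : ∀ a b → CoAdj (adj G) a b → All (λ e → proj₁ e ~ proj₂ e) (projectEdge a b)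
  projectEdge-adjacent (vtx i) (vtx j) (a≢b , nonadj) =
    nonadjacent⇒complement (adj G) i j (λ i≡j → a≢b (cong vtx i≡j)) nonadj ∷ []
  projectEdge-adjacent (vtx i) (vtx′ j) (_ , nonadj) with i ≟ j
  ... | yes _ = []
  ... | no i≢j = nonadjacent⇒complement (adj G) i j i≢j nonadj ∷ []
  projectEdge-adjacent (vtx′ i) (vtx j) (_ , nonadj) with i ≟ j
  ... | yes _ = []
  ... | no i≢j = nonadjacent⇒complement (adj G) i j i≢j nonadj ∷ []
  projectEdge-adjacent (vtx i) uvtx _ = []
  projectEdge-adjacent (vtx′ i) (vtx′ j) _ = []
  projectEdge-adjacent (vtx′ i) uvtx _ = []
  projectEdge-adjacent uvtx _ _ = []

  deg-[]≤ : ∀ x {k} → deg x [] ≤ k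
  deg-[]≤ x = ≤-trans (≤-reflexive (deg-[] x)) z≤n

  deg-projectEdge : ∀ x a b → deg x (projectEdge a b) ≤ incid (vtx x) (a , b) + incid (vtx′ x) (a , b)
  deg-projectEdge x (vtx i) (vtx j) = ≤-reflexive (trans (deg-singleton x i j) (sym (+-identityʳ _)))
  deg-projectEdge x (vtx i) (vtx′ j) with i ≟ j
  ... | yes _ = deg-[]≤ x
  ... | no _ = ≤-reflexive (trans (deg-singleton x i j) (cong (_+ δ x j) (sym (+-identityʳ (δ x i)))))
  deg-projectEdge x (vtx′ i) (vtx j) with i ≟ j
  ... | yes _ = deg-[]≤ x
  ... | no _ = ≤-reflexive (trans (deg-singleton x i j) (trans (+-comm (δ x i) (δ x j)) (cong (δ x j +_) (sym (+-identityʳ _)))))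
  deg-projectEdge x (vtx i) uvtx = deg-[]≤ x
  deg-projectEdge x (vtx′ i) (vtx′ j) = deg-[]≤ x
  deg-projectEdge x (vtx′ i) uvtx = deg-[]≤ x
  deg-projectEdge x uvtx b = deg-[]≤ x

  private
    viaDeg : ∀ {k d} c e → k ≤ d → k ≤ d + c + e
    viaDeg c e h = ≤-trans h (≤-trans (m≤m+n _ c) (m≤m+n _ e))
    viaU : ∀ {k c} d e → k ≤ c → k ≤ d + c + e
    viaU d e h = ≤-trans h (≤-trans (m≤n+m _ d) (m≤m+n _ e))
    viaJoins : ∀ {k e} d c → k ≤ e → k ≤ d + c + e
    viaJoins d c h = ≤-trans h (m≤n+m _ (d + c))
    noU : ∀ {k} → sumFin n (λ _ → 0) ≤ k
    noU = ≤-trans (≤-reflexive (sumFin-zero n (λ _ → refl))) z≤n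

  -- An edge at v_x projects to an H-edge at x unless it goes to u or to v′_x.
  incid-vtx : ∀ x a b → incid (vtx x) (a , b) ≤ deg x (projectEdge a b) + uEdge x a b + joins (vtx x) (vtx′ x) (a , b)
  incid-vtx x (vtx i) (vtx j) = viaDeg 0 (joins (vtx x) (vtx′ x) (vtx i , vtx j)) (≤-reflexive (sym (deg-singleton x i j)))
  incid-vtx x (vtx i) (vtx′ j) with i ≟ j
  ... | yes refl = viaJoins (deg x []) 0 (≤-reflexive (cong (λ b → 𝟙 b + 0) (sym (∧-idem _))))
  ... | no _ = viaDeg 0 (joins (vtx x) (vtx′ x) (vtx i , vtx′ j))
                 (≤-trans (≤-reflexive (+-identityʳ _)) (≤-trans (m≤m+n _ _) (≤-reflexive (sym (deg-singleton x i j)))))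
  incid-vtx x (vtx′ i) (vtx j) with i ≟ j
  ... | yes refl = viaJoins (deg x []) 0 (≤-reflexive (cong 𝟙 (sym (∧-idem _))))
  ... | no _ = viaDeg 0 (joins (vtx x) (vtx′ x) (vtx′ i , vtx j))
                 (≤-trans (m≤n+m _ (δ x i)) (≤-reflexive (sym (deg-singleton x i j))))
  incid-vtx x (vtx i) uvtx = viaU (deg x []) (joins (vtx x) (vtx′ x) (vtx i , uvtx)) (≤-reflexive (+-identityʳ _))
  incid-vtx x uvtx (vtx j) = viaU (deg x []) 0 ≤-refl
  incid-vtx x (vtx′ i) (vtx′ j) = z≤n
  incid-vtx x (vtx′ i) uvtx = z≤n
  incid-vtx x uvtx (vtx′ j) = z≤n
  incid-vtx x uvtx uvtx = z≤n

  sumFin-uEdge : ∀ a b → sumFin n (λ x → uEdge x a b) ≤ incid uvtx (a , b)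
  sumFin-uEdge (vtx i) uvtx = ≤-reflexive (sumFin-δ n i)
  sumFin-uEdge uvtx (vtx j) = ≤-reflexive (trans (sumFin-δ n j) refl)
  sumFin-uEdge (vtx i) (vtx j) = noU
  sumFin-uEdge (vtx i) (vtx′ j) = noU
  sumFin-uEdge (vtx′ i) (vtx j) = noU
  sumFin-uEdge (vtx′ i) (vtx′ j) = noU
  sumFin-uEdge (vtx′ i) uvtx = noU
  sumFin-uEdge uvtx (vtx′ j) = noU
  sumFin-uEdge uvtx uvtx = noU

module LowerBound {n : ℕ} (G : Graph n) (C : MPathCover (adj G)) where
  open PathEdges {n}
  open Projection G
  open StarForest (complementGraph G) using (deg; deg-concat; starMatching-covering)

  q : ℕ
  q = length (mpaths C)

  pathEdges : List Edge
  pathEdges = concat (map edgesOf (mpaths C))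

  projected : List (Fin n × Fin n)
  projected = concat (map (λ e → projectEdge (proj₁ e) (proj₂ e)) pathEdges)

  pathDeg : MVert n → ℕ
  pathDeg m = sumMap (incid m) pathEdges

  uDeg : Fin n → ℕ
  uDeg x = sumMap (λ e → uEdge x (proj₁ e) (proj₂ e)) pathEdges

  sumMap-pathEdges : ∀ f → sumMap f pathEdges ≡ sumMap (λ ps → sumMap f (edgesOf ps)) (mpaths C)
  sumMap-pathEdges f = trans (sumMap-concat f (map edgesOf (mpaths C))) (sumMap-map (sumMap f) edgesOf (mpaths C))

  deg-projected : ∀ x → deg x projected ≡ sumMap (λ e → deg x (projectEdge (proj₁ e) (proj₂ e))) pathEdges
  deg-projected x = trans (deg-concat x (map _ pathEdges)) (sumMap-map (deg x) _ pathEdges)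

  projected-adjacent : All (λ e → StarForest._~_ (complementGraph G) (proj₁ e) (proj₂ e)) projected
  projected-adjacent = Allₚ.concat⁺ (Allₚ.map⁺ (All.map (λ {e} → projectEdge-adjacent (proj₁ e) (proj₂ e))
                                       (Allₚ.concat⁺ (Allₚ.map⁺ (All.map edgesOf-linked (mlinked C))))))

  pathDeg≤2 : ∀ m → pathDeg m ≤ 2
  pathDeg≤2 m = begin
    pathDeg m                                        ≡⟨ sumMap-pathEdges (incid m) ⟩
    sumMap (λ ps → sumMap (incid m) (edgesOf ps)) (mpaths C) ≤⟨ sumMap-mono (mpaths C) (incid-edgesOf≤ m) ⟩
    sumMap (λ ps → 2 * occᴹ m ps) (mpaths C)         ≡⟨ sumMap-2* (occᴹ m) (mpaths C) ⟩
    2 * sumMap (occᴹ m) (mpaths C)                   ≡⟨ cong (2 *_) (sym (OccMVert.occ-concat m (mpaths C))) ⟩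
    2 * occᴹ m (concat (mpaths C))                   ≡⟨ cong (2 *_) (partition C m) ⟩
    2                                                ∎
    where open ≤-Reasoning

  deg-projected≤4 : ∀ x → deg x projected ≤ 4
  deg-projected≤4 x = begin
    deg x projected                                       ≡⟨ deg-projected x ⟩
    sumMap (λ e → deg x (projectEdge (proj₁ e) (proj₂ e))) pathEdges
      ≤⟨ sumMap-mono pathEdges (λ e → deg-projectEdge x (proj₁ e) (proj₂ e)) ⟩
    sumMap (λ e → incid (vtx x) e + incid (vtx′ x) e) pathEdges ≡⟨ sumMap-+ _ _ pathEdges ⟩
    pathDeg (vtx x) + pathDeg (vtx′ x)                    ≤⟨ +-mono-≤ (pathDeg≤2 (vtx x)) (pathDeg≤2 (vtx′ x)) ⟩
    4                                                     ∎
    where open ≤-Reasoning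

  sum-pathDeg : sumMVert n pathDeg ≡ 2 * length pathEdges
  sum-pathDeg = begin
    sumMVert n pathDeg                                         ≡⟨ sumMVert-sumMap n incid pathEdges ⟩
    sumMap (λ e → sumMVert n (λ m → incid m e)) pathEdges      ≡⟨ sumMap-cong pathEdges twoEnds ⟩
    sumMap (λ _ → 2 * 1) pathEdges                             ≡⟨ sumMap-2* (λ _ → 1) pathEdges ⟩
    2 * sumMap (λ _ → 1) pathEdges                             ≡⟨ cong (2 *_) (sumMap-one pathEdges) ⟩
    2 * length pathEdges                                       ∎
    where
      open ≡-Reasoning
      twoEnds : ∀ e → sumMVert n (λ m → incid m e) ≡ 2 * 1
      twoEnds (a , b) = trans (sumMVert-+ n (λ m → δᴹ m a) (λ m → δᴹ m b)) (cong₂ _+_ (sumMVert-δ n a) (sumMVert-δ n b))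

  length-pathEdges : length pathEdges + q ≡ 1 + (n + n)
  length-pathEdges = begin
    length pathEdges + q                       ≡⟨ length-edgesOf-concat (mpaths C) (mnonempty C) ⟩
    length (concat (mpaths C))                 ≡⟨ sym (sumMVert-occ n (concat (mpaths C))) ⟩
    sumMVert n (λ m → occᴹ m (concat (mpaths C))) ≡⟨ sumMVert-cong n (partition C) ⟩
    sumMVert n (λ _ → 1)                       ≡⟨ trans (sumMVert-const n 1) (*-identityʳ _) ⟩
    1 + (n + n)                                ∎
    where open ≡-Reasoning

  -- Every path has two endpoints (counted twice for a one-vertex path).
  pathEnds : sumMVert n (λ m → 2 ∸ pathDeg m) ≡ 2 * q
  pathEnds = +-cancelʳ-≡ _ _ _ (begin
    sumMVert n (λ m → 2 ∸ pathDeg m) + sumMVert n pathDeg  ≡⟨ sym (sumMVert-+ n (λ m → 2 ∸ pathDeg m) pathDeg) ⟩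
    sumMVert n (λ m → 2 ∸ pathDeg m + pathDeg m)           ≡⟨ sumMVert-cong n (λ m → m∸n+n≡m (pathDeg≤2 m)) ⟩
    sumMVert n (λ _ → 2)                                   ≡⟨ sumMVert-const n 2 ⟩
    (1 + (n + n)) * 2                                      ≡⟨ cong (_* 2) (sym length-pathEdges) ⟩
    (length pathEdges + q) * 2                             ≡⟨ reorder (length pathEdges) q ⟩
    2 * q + 2 * length pathEdges                           ≡⟨ cong (2 * q +_) (sym sum-pathDeg) ⟩
    2 * q + sumMVert n pathDeg                             ∎)
    where
      open ≡-Reasoning
      reorder : ∀ a b → (a + b) * 2 ≡ 2 * b + 2 * a
      reorder = solve-∀

  vvJoins≤1 : ∀ x → sumMap (joins (vtx x) (vtx′ x)) pathEdges ≤ 1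
  vvJoins≤1 x = begin
    sumMap (joins (vtx x) (vtx′ x)) pathEdges    ≡⟨ sumMap-pathEdges _ ⟩
    sumMap (λ ps → sumMap (joins (vtx x) (vtx′ x)) (edgesOf ps)) (mpaths C)
      ≤⟨ joins-concat≤ {vtx x} {vtx′ x} (λ ()) (mpaths C) (λ k → ≤-reflexive (partition C k)) ⟩
    occᴹ (vtx x) (concat (mpaths C))              ≡⟨ partition C (vtx x) ⟩
    1                                             ∎
    where open ≤-Reasoning

  pathDeg-vtx : ∀ x → pathDeg (vtx x) ≤ deg x projected + uDeg x + sumMap (joins (vtx x) (vtx′ x)) pathEdges
  pathDeg-vtx x = begin
    pathDeg (vtx x)
      ≤⟨ sumMap-mono pathEdges (λ e → incid-vtx x (proj₁ e) (proj₂ e)) ⟩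
    sumMap (λ e → deg x (projectEdge (proj₁ e) (proj₂ e)) + uEdge x (proj₁ e) (proj₂ e) + joins (vtx x) (vtx′ x) e) pathEdges
      ≡⟨ sumMap-+ _ _ pathEdges ⟩
    sumMap (λ e → deg x (projectEdge (proj₁ e) (proj₂ e)) + uEdge x (proj₁ e) (proj₂ e)) pathEdges + sumMap (joins (vtx x) (vtx′ x)) pathEdges
      ≡⟨ cong (_+ sumMap (joins (vtx x) (vtx′ x)) pathEdges) (sumMap-+ _ _ pathEdges) ⟩
    sumMap (λ e → deg x (projectEdge (proj₁ e) (proj₂ e))) pathEdges + uDeg x + sumMap (joins (vtx x) (vtx′ x)) pathEdges
      ≡⟨ cong (λ k → k + uDeg x + sumMap (joins (vtx x) (vtx′ x)) pathEdges) (sym (deg-projected x)) ⟩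
    deg x projected + uDeg x + sumMap (joins (vtx x) (vtx′ x)) pathEdges ∎
    where open ≤-Reasoning

  -- If x is isolated in the projection, v_x is a path end or lies next to u:
  -- both its path edges cannot go to v′_x.
  isolated⇒end-or-u : ∀ x → 𝟙 (deg x projected ≡ᵇ 0) ≤ (2 ∸ pathDeg (vtx x)) + uDeg x
  isolated⇒end-or-u x with deg x projected in isolated
  ... | suc _ = z≤n
  ... | zero = helper (pathDeg (vtx x)) (uDeg x) (subst (λ k → pathDeg (vtx x) ≤ k + uDeg x + sumMap (joins (vtx x) (vtx′ x)) pathEdges) isolated (pathDeg-vtx x)) (vvJoins≤1 x)
    where
      helper : ∀ d u {j} → d ≤ 0 + u + j → j ≤ 1 → 1 ≤ (2 ∸ d) + u
      helper d (suc u) _ _ = ≤-trans (s≤s z≤n) (m≤n+m (suc u) (2 ∸ d))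
      helper zero zero _ _ = s≤s z≤n
      helper (suc zero) zero _ _ = s≤s z≤n
      helper (suc (suc d)) zero {suc (suc j)} _ (s≤s ())
      helper (suc (suc d)) zero {suc zero} (s≤s ()) _
      helper (suc (suc d)) zero {zero} () _

  sum-uDeg≤2 : sumFin n uDeg ≤ 2
  sum-uDeg≤2 = begin
    sumFin n uDeg                                                   ≡⟨ sumFin-sumMap n (λ x e → uEdge x (proj₁ e) (proj₂ e)) pathEdges ⟩
    sumMap (λ e → sumFin n (λ x → uEdge x (proj₁ e) (proj₂ e))) pathEdges ≤⟨ sumMap-mono pathEdges (λ e → sumFin-uEdge (proj₁ e) (proj₂ e)) ⟩
    pathDeg uvtx                                                    ≤⟨ pathDeg≤2 uvtx ⟩
    2                                                               ∎
    where open ≤-Reasoning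

  isolatedCount≤ : sumFin n (λ x → 𝟙 (deg x projected ≡ᵇ 0)) ≤ 2 * q + 2
  isolatedCount≤ = begin
    sumFin n (λ x → 𝟙 (deg x projected ≡ᵇ 0))                 ≤⟨ sumFin-mono n isolated⇒end-or-u ⟩
    sumFin n (λ x → (2 ∸ pathDeg (vtx x)) + uDeg x)            ≡⟨ sumFin-+ n _ _ ⟩
    sumFin n (λ x → 2 ∸ pathDeg (vtx x)) + sumFin n uDeg       ≤⟨ +-mono-≤ vtxEnds sum-uDeg≤2 ⟩
    2 * q + 2                                                  ∎
    where
      open ≤-Reasoning
      vtxEnds : sumFin n (λ x → 2 ∸ pathDeg (vtx x)) ≤ 2 * q
      vtxEnds = ≤-trans (≤-trans (m≤m+n _ _) (m≤n+m _ (2 ∸ pathDeg uvtx))) (≤-reflexive pathEnds)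

  lowerBound : Σ (StarMatching (complement (adj G))) (λ M → n ≤ smSize M + (2 * q + 2))
  lowerBound with starMatching-covering projected projected-adjacent deg-projected≤4
  ... | M , covering = M , ≤-trans covering (+-monoʳ-≤ (smSize M) isolatedCount≤)

-- The upper bound: a path cover from a 4-star matching

module UpperBound {n : ℕ} (G : Graph n) where

  private
    A : Adj n
    A = adj G

  NotMycAdj : MVert n → MVert n → Set
  NotMycAdj m m′ = mycAdj A m m′ ≡ false

  data PrimedEnd : Maybe (MVert n) → Set where
    none : PrimedEnd nothing
    primed : ∀ i → PrimedEnd (just (vtx′ i))

  -- the v′ form a clique in the complement of M(G)
  primed-connected : ∀ {a b} → PrimedEnd a → PrimedEnd b → Connected NotMycAdj a b
  primed-connected none none = nothing
  primed-connected none (primed j) = nothing-just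
  primed-connected (primed i) none = just-nothing
  primed-connected (primed i) (primed j) = just refl

  head-++ : ∀ xs ys → PrimedEnd (head xs) → PrimedEnd (head ys) → PrimedEnd (head (xs ++ ys))
  head-++ [] ys _ p = p
  head-++ (x ∷ xs) ys p _ = p

  last-++ : ∀ xs ys → PrimedEnd (last xs) → PrimedEnd (last ys) → PrimedEnd (last (xs ++ ys))
  last-++ [] ys _ p = p
  last-++ (x ∷ []) [] p _ = p
  last-++ (x ∷ []) (y ∷ ys) _ p = p
  last-++ (x ∷ y ∷ xs) ys p q = last-++ (y ∷ xs) ys p q

  ++-linked : ∀ {xs ys} → Linked NotMycAdj xs → Linked NotMycAdj ys →
              PrimedEnd (last xs) → PrimedEnd (head ys) → Linked NotMycAdj (xs ++ ys)
  ++-linked lx ly p q = Linkedₚ.++⁺ lx (primed-connected p q) ly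

  leaf-nonadj : ∀ {c l} → complement A ⊢ c ~ l → A c l ≡ false
  leaf-nonadj {c} {l} h = proj₂ (complement⇒nonadjacent A c l h)

  leaf-nonadj′ : ∀ {c l} → complement A ⊢ c ~ l → A l c ≡ false
  leaf-nonadj′ {c} {l} h = trans (Graph.sym G _ c) (leaf-nonadj h)

  -- The star with centre c and leaves l₁ … l_k, traversed from v′_{l₁} to a primed vertex:
  -- v′₁ v₁ v_c v′_c (k = 1), v′₁ v₁ v_c v₂ v′₂ v′_c (k = 2),
  -- v′₁ v₁ v_c v₂ v′₂ v′₃ v₃ v′_c (k = 3), v′₁ v₁ v_c v₂ v′₂ v′₃ v₃ v′_c v₄ v′₄ (k = 4).
  afterFirstLeaf : Fin n → List (Fin n) → List (MVert n)
  afterFirstLeaf c [] = vtx c ∷ vtx′ c ∷ []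
  afterFirstLeaf c (l₂ ∷ []) = vtx c ∷ vtx l₂ ∷ vtx′ l₂ ∷ vtx′ c ∷ []
  afterFirstLeaf c (l₂ ∷ l₃ ∷ []) = vtx c ∷ vtx l₂ ∷ vtx′ l₂ ∷ vtx′ l₃ ∷ vtx l₃ ∷ vtx′ c ∷ []
  afterFirstLeaf c (l₂ ∷ l₃ ∷ l₄ ∷ _) = vtx c ∷ vtx l₂ ∷ vtx′ l₂ ∷ vtx′ l₃ ∷ vtx l₃ ∷ vtx′ c ∷ vtx l₄ ∷ vtx′ l₄ ∷ []

  starSegment : Fin n → List (Fin n) → List (MVert n)
  starSegment c [] = []
  starSegment c (l₁ ∷ ls) = vtx′ l₁ ∷ vtx l₁ ∷ afterFirstLeaf c ls

  starSegmentU : Fin n → List (Fin n) → List (MVert n)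
  starSegmentU c [] = uvtx ∷ []
  starSegmentU c (l₁ ∷ ls) = vtx′ l₁ ∷ vtx l₁ ∷ uvtx ∷ afterFirstLeaf c ls

  Leaves : Fin n → List (Fin n) → Set
  Leaves c ls = All (λ l → complement A ⊢ c ~ l) ls

  afterFirstLeaf-linked : ∀ c ls → Leaves c ls → length ls ≤ 3 → Linked NotMycAdj (afterFirstLeaf c ls)
  afterFirstLeaf-linked c [] _ _ = irrefl G c ∷ [-]
  afterFirstLeaf-linked c (l₂ ∷ []) (h₂ ∷ []) _ = leaf-nonadj h₂ ∷ irrefl G l₂ ∷ refl ∷ [-]
  afterFirstLeaf-linked c (l₂ ∷ l₃ ∷ []) (h₂ ∷ h₃ ∷ []) _ =
    leaf-nonadj h₂ ∷ irrefl G l₂ ∷ refl ∷ irrefl G l₃ ∷ leaf-nonadj′ h₃ ∷ [-]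
  afterFirstLeaf-linked c (l₂ ∷ l₃ ∷ l₄ ∷ []) (h₂ ∷ h₃ ∷ h₄ ∷ []) _ =
    leaf-nonadj h₂ ∷ irrefl G l₂ ∷ refl ∷ irrefl G l₃ ∷ leaf-nonadj′ h₃ ∷ leaf-nonadj h₄ ∷ irrefl G l₄ ∷ [-]
  afterFirstLeaf-linked c (_ ∷ _ ∷ _ ∷ _ ∷ _) _ (s≤s (s≤s (s≤s ())))

  afterFirstLeaf-head : ∀ c ls → Σ (List (MVert n)) (λ t → afterFirstLeaf c ls ≡ vtx c ∷ t)
  afterFirstLeaf-head c [] = _ , refl
  afterFirstLeaf-head c (_ ∷ []) = _ , refl
  afterFirstLeaf-head c (_ ∷ _ ∷ []) = _ , refl
  afterFirstLeaf-head c (_ ∷ _ ∷ _ ∷ _) = _ , refl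

  starSegment-linked : ∀ c ls → Leaves c ls → length ls ≤ 4 → Linked NotMycAdj (starSegment c ls)
  starSegment-linked c [] _ _ = []
  starSegment-linked c (l₁ ∷ ls) (h₁ ∷ hs) (s≤s k≤3) with afterFirstLeaf-head c ls | afterFirstLeaf-linked c ls hs k≤3
  ... | _ , eq | linked rewrite eq = irrefl G l₁ ∷ leaf-nonadj′ h₁ ∷ linked

  starSegmentU-linked : ∀ c ls → Leaves c ls → length ls ≤ 4 → Linked NotMycAdj (starSegmentU c ls)
  starSegmentU-linked c [] _ _ = [-]
  starSegmentU-linked c (l₁ ∷ ls) (h₁ ∷ hs) (s≤s k≤3) with afterFirstLeaf-head c ls | afterFirstLeaf-linked c ls hs k≤3
  ... | _ , eq | linked rewrite eq = irrefl G l₁ ∷ refl ∷ refl ∷ linked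

  starSegment-head : ∀ c ls → PrimedEnd (head (starSegment c ls))
  starSegment-head c [] = none
  starSegment-head c (l₁ ∷ ls) = primed l₁

  starSegment-last : ∀ c ls → PrimedEnd (last (starSegment c ls))
  starSegment-last c [] = none
  starSegment-last c (l₁ ∷ []) = primed c
  starSegment-last c (l₁ ∷ _ ∷ []) = primed c
  starSegment-last c (l₁ ∷ _ ∷ _ ∷ []) = primed c
  starSegment-last c (l₁ ∷ _ ∷ _ ∷ l₄ ∷ _) = primed l₄

  starSegmentU-last : ∀ c ls → 1 ≤ length ls → PrimedEnd (last (starSegmentU c ls))
  starSegmentU-last c (l₁ ∷ []) _ = primed c
  starSegmentU-last c (l₁ ∷ _ ∷ []) _ = primed c
  starSegmentU-last c (l₁ ∷ _ ∷ _ ∷ []) _ = primed c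
  starSegmentU-last c (l₁ ∷ _ ∷ _ ∷ l₄ ∷ _) _ = primed l₄

  copies : MVert n → List (Fin n) → ℕ
  copies m xs = occᴹ m (map vtx xs) + occᴹ m (map vtx′ xs)

  copies-++ : ∀ m xs ys → copies m (xs ++ ys) ≡ copies m xs + copies m ys
  copies-++ m xs ys rewrite map-++ vtx xs ys | map-++ vtx′ xs ys
    | OccMVert.occ-++ m (map vtx xs) (map vtx ys) | OccMVert.occ-++ m (map vtx′ xs) (map vtx′ ys) =
    interchange (occᴹ m (map vtx xs)) (occᴹ m (map vtx ys)) _ _

  copies-vtx : ∀ i xs → copies (vtx i) xs ≡ occ i xs + 0
  copies-vtx i xs = cong₂ _+_ (sumMap-map _ vtx xs) (trans (sumMap-map _ vtx′ xs) (sumMap-zero xs (λ _ → refl)))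

  copies-vtx′ : ∀ i xs → copies (vtx′ i) xs ≡ 0 + occ i xs
  copies-vtx′ i xs = cong₂ _+_ (trans (sumMap-map _ vtx xs) (sumMap-zero xs (λ _ → refl))) (sumMap-map _ vtx′ xs)

  copies-uvtx : ∀ xs → copies uvtx xs ≡ 0
  copies-uvtx xs = cong₂ _+_ (trans (sumMap-map _ vtx xs) (sumMap-zero xs (λ _ → refl)))
                             (trans (sumMap-map _ vtx′ xs) (sumMap-zero xs (λ _ → refl)))

  -- The segments below are rearrangements of the two copies of their vertex lists.
  occ-starSegment : ∀ m c ls → 1 ≤ length ls → length ls ≤ 4 → occᴹ m (starSegment c ls) ≡ copies m (c ∷ ls)
  occ-starSegment m c (l₁ ∷ []) _ _ = rearrange (δᴹ m (vtx c)) (δᴹ m (vtx′ c)) (δᴹ m (vtx l₁)) (δᴹ m (vtx′ l₁))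
    where
      rearrange : ∀ vc wc v₁ w₁ → w₁ + (v₁ + (vc + (wc + 0))) ≡ (vc + (v₁ + 0)) + (wc + (w₁ + 0))
      rearrange = solve-∀
  occ-starSegment m c (l₁ ∷ l₂ ∷ []) _ _ =
    rearrange (δᴹ m (vtx c)) (δᴹ m (vtx′ c)) (δᴹ m (vtx l₁)) (δᴹ m (vtx′ l₁)) (δᴹ m (vtx l₂)) (δᴹ m (vtx′ l₂))
    where
      rearrange : ∀ vc wc v₁ w₁ v₂ w₂ →
        w₁ + (v₁ + (vc + (v₂ + (w₂ + (wc + 0))))) ≡ (vc + (v₁ + (v₂ + 0))) + (wc + (w₁ + (w₂ + 0)))
      rearrange = solve-∀
  occ-starSegment m c (l₁ ∷ l₂ ∷ l₃ ∷ []) _ _ =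
    rearrange (δᴹ m (vtx c)) (δᴹ m (vtx′ c)) (δᴹ m (vtx l₁)) (δᴹ m (vtx′ l₁)) (δᴹ m (vtx l₂)) (δᴹ m (vtx′ l₂))
              (δᴹ m (vtx l₃)) (δᴹ m (vtx′ l₃))
    where
      rearrange : ∀ vc wc v₁ w₁ v₂ w₂ v₃ w₃ →
        w₁ + (v₁ + (vc + (v₂ + (w₂ + (w₃ + (v₃ + (wc + 0)))))))
          ≡ (vc + (v₁ + (v₂ + (v₃ + 0)))) + (wc + (w₁ + (w₂ + (w₃ + 0))))
      rearrange = solve-∀
  occ-starSegment m c (l₁ ∷ l₂ ∷ l₃ ∷ l₄ ∷ []) _ _ =
    rearrange (δᴹ m (vtx c)) (δᴹ m (vtx′ c)) (δᴹ m (vtx l₁)) (δᴹ m (vtx′ l₁)) (δᴹ m (vtx l₂)) (δᴹ m (vtx′ l₂))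
              (δᴹ m (vtx l₃)) (δᴹ m (vtx′ l₃)) (δᴹ m (vtx l₄)) (δᴹ m (vtx′ l₄))
    where
      rearrange : ∀ vc wc v₁ w₁ v₂ w₂ v₃ w₃ v₄ w₄ →
        w₁ + (v₁ + (vc + (v₂ + (w₂ + (w₃ + (v₃ + (wc + (v₄ + (w₄ + 0)))))))))
          ≡ (vc + (v₁ + (v₂ + (v₃ + (v₄ + 0))))) + (wc + (w₁ + (w₂ + (w₃ + (w₄ + 0)))))
      rearrange = solve-∀
  occ-starSegment m c (_ ∷ _ ∷ _ ∷ _ ∷ _ ∷ _) _ (s≤s (s≤s (s≤s (s≤s ()))))

  occ-starSegmentU : ∀ m c ls → 1 ≤ length ls → length ls ≤ 4 → occᴹ m (starSegmentU c ls) ≡ δᴹ m uvtx + copies m (c ∷ ls)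
  occ-starSegmentU m c (l₁ ∷ ls) 1≤k k≤4 =
    trans (moveU (δᴹ m (vtx′ l₁)) (δᴹ m (vtx l₁)) (δᴹ m uvtx) (occᴹ m (afterFirstLeaf c ls)))
          (cong (δᴹ m uvtx +_) (occ-starSegment m c (l₁ ∷ ls) 1≤k k≤4))
    where
      moveU : ∀ p q r s → p + (q + (r + s)) ≡ r + (p + (q + s))
      moveU = solve-∀

  Star : Set
  Star = Star4 (complement A)

  segment : Star → List (MVert n)
  segment s = starSegment (centre s) (leaves s)

  starsPath : List Star → List (MVert n)
  starsPath S = concat (map segment S)

  starsPath-head : ∀ S → PrimedEnd (head (starsPath S))
  starsPath-head [] = none
  starsPath-head (s ∷ S) = head-++ (segment s) (starsPath S) (starSegment-head (centre s) (leaves s)) (starsPath-head S)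

  starsPath-last : ∀ S → PrimedEnd (last (starsPath S))
  starsPath-last [] = none
  starsPath-last (s ∷ S) = last-++ (segment s) (starsPath S) (starSegment-last (centre s) (leaves s)) (starsPath-last S)

  starsPath-linked : ∀ S → Linked NotMycAdj (starsPath S)
  starsPath-linked [] = []
  starsPath-linked (s ∷ S) =
    ++-linked (starSegment-linked (centre s) (leaves s) (adjacent s) (atmost4 s)) (starsPath-linked S)
      (starSegment-last (centre s) (leaves s)) (starsPath-head S)

  occ-starsPath : ∀ m S → occᴹ m (starsPath S) ≡ copies m (concat (map starVertices S))
  occ-starsPath m [] = refl
  occ-starsPath m (s ∷ S) = begin
    occᴹ m (segment s ++ starsPath S)
      ≡⟨ OccMVert.occ-++ m (segment s) (starsPath S) ⟩
    occᴹ m (segment s) + occᴹ m (starsPath S)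
      ≡⟨ cong₂ _+_ (occ-starSegment m (centre s) (leaves s) (nonempty s) (atmost4 s)) (occ-starsPath m S) ⟩
    copies m (starVertices s) + copies m (concat (map starVertices S))
      ≡⟨ sym (copies-++ m (starVertices s) (concat (map starVertices S))) ⟩
    copies m (concat (map starVertices (s ∷ S))) ∎
    where open ≡-Reasoning

  pairPaths : List (Fin n) → List (List (MVert n))
  pairPaths [] = []
  pairPaths (a ∷ []) = (vtx a ∷ vtx′ a ∷ []) ∷ []
  pairPaths (a ∷ b ∷ r) = (vtx a ∷ vtx′ a ∷ vtx′ b ∷ vtx b ∷ []) ∷ pairPaths r

  pairPaths-nonempty : ∀ r → All (λ p → 1 ≤ length p) (pairPaths r)
  pairPaths-nonempty [] = []
  pairPaths-nonempty (a ∷ []) = s≤s z≤n ∷ []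
  pairPaths-nonempty (a ∷ b ∷ r) = s≤s z≤n ∷ pairPaths-nonempty r

  pairPaths-linked : ∀ r → All (Linked NotMycAdj) (pairPaths r)
  pairPaths-linked [] = []
  pairPaths-linked (a ∷ []) = (irrefl G a ∷ [-]) ∷ []
  pairPaths-linked (a ∷ b ∷ r) = (irrefl G a ∷ refl ∷ irrefl G b ∷ [-]) ∷ pairPaths-linked r

  occ-pairPaths : ∀ m r → occᴹ m (concat (pairPaths r)) ≡ copies m r
  occ-pairPaths m [] = refl
  occ-pairPaths m (a ∷ []) = rearrange (δᴹ m (vtx a)) (δᴹ m (vtx′ a))
    where
      rearrange : ∀ p q → p + (q + 0) ≡ (p + 0) + (q + 0)
      rearrange = solve-∀
  occ-pairPaths m (a ∷ b ∷ r) =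
    trans (OccMVert.occ-++ m (vtx a ∷ vtx′ a ∷ vtx′ b ∷ vtx b ∷ []) (concat (pairPaths r)))
      (trans (cong (_ +_) (occ-pairPaths m r))
        (rearrange (δᴹ m (vtx a)) (δᴹ m (vtx′ a)) (δᴹ m (vtx b)) (δᴹ m (vtx′ b)) (occᴹ m (map vtx r)) (occᴹ m (map vtx′ r))))
    where
      rearrange : ∀ va wa vb wb V W → va + (wa + (wb + (vb + 0))) + (V + W) ≡ (va + (vb + V)) + (wa + (wb + W))
      rearrange = solve-∀

  length-pairPaths : ∀ r → 2 * length (pairPaths r) ≤ length r + 1
  length-pairPaths [] = z≤n
  length-pairPaths (a ∷ []) = s≤s (s≤s z≤n)
  length-pairPaths (a ∷ b ∷ r) =
    subst₂ _≤_ (sym (*-distribˡ-+ 2 1 (length (pairPaths r)))) refl (+-monoʳ-≤ 2 (length-pairPaths r))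

  uDetour : Fin n → Fin n → List (MVert n)
  uDetour x₂ x₃ = vtx′ x₂ ∷ vtx x₂ ∷ uvtx ∷ vtx x₃ ∷ vtx′ x₃ ∷ []

  uDetour⁺ : Fin n → Fin n → Fin n → List (MVert n)
  uDetour⁺ x₂ x₃ x₄ = vtx′ x₂ ∷ vtx x₂ ∷ uvtx ∷ vtx x₃ ∷ vtx′ x₃ ∷ vtx′ x₄ ∷ vtx x₄ ∷ []

  matched : List Star → List (Fin n)
  matched S = concat (map starVertices S)

  -- The first path carries u, all stars and the first (up to four) unmatched vertices;
  -- the remaining unmatched vertices are covered two per path by `pairPaths`.
  firstPath : List (Fin n) → List Star → List (MVert n)
  firstPath [] [] = uvtx ∷ []
  firstPath [] (s ∷ S) = starSegmentU (centre s) (leaves s) ++ starsPath S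
  firstPath (x₁ ∷ []) S = uvtx ∷ vtx x₁ ∷ vtx′ x₁ ∷ starsPath S
  firstPath (x₁ ∷ x₂ ∷ []) S = vtx x₁ ∷ uvtx ∷ vtx x₂ ∷ vtx′ x₂ ∷ (starsPath S ++ vtx′ x₁ ∷ [])
  firstPath (x₁ ∷ x₂ ∷ x₃ ∷ []) S = vtx x₁ ∷ vtx′ x₁ ∷ (starsPath S ++ uDetour x₂ x₃)
  firstPath (x₁ ∷ x₂ ∷ x₃ ∷ x₄ ∷ _) S = vtx x₁ ∷ vtx′ x₁ ∷ (starsPath S ++ uDetour⁺ x₂ x₃ x₄)

  coverPaths : List (Fin n) → List Star → List (List (MVert n))
  coverPaths Us S = firstPath Us S ∷ pairPaths (drop 4 Us)

  firstPath-nonempty : ∀ Us S → 1 ≤ length (firstPath Us S)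
  firstPath-nonempty [] [] = s≤s z≤n
  firstPath-nonempty [] (s ∷ S) with leaves s
  ... | [] = s≤s z≤n
  ... | _ ∷ _ = s≤s z≤n
  firstPath-nonempty (x₁ ∷ []) S = s≤s z≤n
  firstPath-nonempty (x₁ ∷ x₂ ∷ []) S = s≤s z≤n
  firstPath-nonempty (x₁ ∷ x₂ ∷ x₃ ∷ []) S = s≤s z≤n
  firstPath-nonempty (x₁ ∷ x₂ ∷ x₃ ∷ x₄ ∷ _) S = s≤s z≤n

  firstPath-linked : ∀ Us S → Linked NotMycAdj (firstPath Us S)
  firstPath-linked [] [] = [-]
  firstPath-linked [] (s ∷ S) =
    ++-linked (starSegmentU-linked (centre s) (leaves s) (adjacent s) (atmost4 s)) (starsPath-linked S)
      (starSegmentU-last (centre s) (leaves s) (nonempty s)) (starsPath-head S)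
  firstPath-linked (x₁ ∷ []) S =
    refl ∷ irrefl G x₁ ∷ ++-linked [-] (starsPath-linked S) (primed x₁) (starsPath-head S)
  firstPath-linked (x₁ ∷ x₂ ∷ []) S =
    refl ∷ refl ∷ irrefl G x₂ ∷ ++-linked [-] (++-linked (starsPath-linked S) [-] (starsPath-last S) (primed x₁))
                                   (primed x₂) (head-++ (starsPath S) _ (starsPath-head S) (primed x₁))
  firstPath-linked (x₁ ∷ x₂ ∷ x₃ ∷ []) S =
    irrefl G x₁ ∷ ++-linked [-] (++-linked (starsPath-linked S) detour (starsPath-last S) (primed x₂))
                          (primed x₁) (head-++ (starsPath S) _ (starsPath-head S) (primed x₂))
    where
      detour : Linked NotMycAdj (uDetour x₂ x₃)
      detour = irrefl G x₂ ∷ refl ∷ refl ∷ irrefl G x₃ ∷ [-]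
  firstPath-linked (x₁ ∷ x₂ ∷ x₃ ∷ x₄ ∷ _) S =
    irrefl G x₁ ∷ ++-linked [-] (++-linked (starsPath-linked S) detour (starsPath-last S) (primed x₂))
                          (primed x₁) (head-++ (starsPath S) _ (starsPath-head S) (primed x₂))
    where
      detour : Linked NotMycAdj (uDetour⁺ x₂ x₃ x₄)
      detour = irrefl G x₂ ∷ refl ∷ refl ∷ irrefl G x₃ ∷ refl ∷ irrefl G x₄ ∷ [-]

  occ-starsPath-++ : ∀ m S t → occᴹ m (starsPath S ++ t) ≡ copies m (matched S) + occᴹ m t
  occ-starsPath-++ m S t = trans (OccMVert.occ-++ m (starsPath S) t) (cong (_+ occᴹ m t) (occ-starsPath m S))

  occ-firstPath : ∀ m Us S → occᴹ m (firstPath Us S) ≡ δᴹ m uvtx + (copies m (matched S) + copies m (take 4 Us))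
  occ-firstPath m [] [] = refl
  occ-firstPath m [] (s ∷ S) = begin
    occᴹ m (segmentU ++ starsPath S)
      ≡⟨ OccMVert.occ-++ m segmentU (starsPath S) ⟩
    occᴹ m segmentU + occᴹ m (starsPath S)
      ≡⟨ cong₂ _+_ (occ-starSegmentU m (centre s) (leaves s) (nonempty s) (atmost4 s)) (occ-starsPath m S) ⟩
    δᴹ m uvtx + copies m (starVertices s) + copies m (matched S)
      ≡⟨ trans (+-assoc (δᴹ m uvtx) _ _) (cong (δᴹ m uvtx +_) (sym (copies-++ m (starVertices s) (matched S)))) ⟩
    δᴹ m uvtx + copies m (matched (s ∷ S))
      ≡⟨ cong (δᴹ m uvtx +_) (sym (+-identityʳ _)) ⟩
    δᴹ m uvtx + (copies m (matched (s ∷ S)) + copies m []) ∎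
    where
      open ≡-Reasoning
      segmentU = starSegmentU (centre s) (leaves s)
  occ-firstPath m (x₁ ∷ []) S rewrite occ-starsPath m S =
    rearrange (δᴹ m uvtx) (δᴹ m (vtx x₁)) (δᴹ m (vtx′ x₁)) (copies m (matched S))
    where
      rearrange : ∀ u v₁ w₁ X → u + (v₁ + (w₁ + X)) ≡ u + (X + ((v₁ + 0) + (w₁ + 0)))
      rearrange = solve-∀
  occ-firstPath m (x₁ ∷ x₂ ∷ []) S rewrite occ-starsPath-++ m S (vtx′ x₁ ∷ []) =
    rearrange (δᴹ m uvtx) (δᴹ m (vtx x₁)) (δᴹ m (vtx′ x₁)) (δᴹ m (vtx x₂)) (δᴹ m (vtx′ x₂)) (copies m (matched S))
    where
      rearrange : ∀ u v₁ w₁ v₂ w₂ X →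
        v₁ + (u + (v₂ + (w₂ + (X + (w₁ + 0))))) ≡ u + (X + ((v₁ + (v₂ + 0)) + (w₁ + (w₂ + 0))))
      rearrange = solve-∀
  occ-firstPath m (x₁ ∷ x₂ ∷ x₃ ∷ []) S rewrite occ-starsPath-++ m S (uDetour x₂ x₃) =
    rearrange (δᴹ m uvtx) (δᴹ m (vtx x₁)) (δᴹ m (vtx′ x₁)) (δᴹ m (vtx x₂)) (δᴹ m (vtx′ x₂))
              (δᴹ m (vtx x₃)) (δᴹ m (vtx′ x₃)) (copies m (matched S))
    where
      rearrange : ∀ u v₁ w₁ v₂ w₂ v₃ w₃ X →
        v₁ + (w₁ + (X + (w₂ + (v₂ + (u + (v₃ + (w₃ + 0)))))))
          ≡ u + (X + ((v₁ + (v₂ + (v₃ + 0))) + (w₁ + (w₂ + (w₃ + 0)))))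
      rearrange = solve-∀
  occ-firstPath m (x₁ ∷ x₂ ∷ x₃ ∷ x₄ ∷ _) S rewrite occ-starsPath-++ m S (uDetour⁺ x₂ x₃ x₄) =
    rearrange (δᴹ m uvtx) (δᴹ m (vtx x₁)) (δᴹ m (vtx′ x₁)) (δᴹ m (vtx x₂)) (δᴹ m (vtx′ x₂))
              (δᴹ m (vtx x₃)) (δᴹ m (vtx′ x₃)) (δᴹ m (vtx x₄)) (δᴹ m (vtx′ x₄)) (copies m (matched S))
    where
      rearrange : ∀ u v₁ w₁ v₂ w₂ v₃ w₃ v₄ w₄ X →
        v₁ + (w₁ + (X + (w₂ + (v₂ + (u + (v₃ + (w₃ + (w₄ + (v₄ + 0)))))))))
          ≡ u + (X + ((v₁ + (v₂ + (v₃ + (v₄ + 0)))) + (w₁ + (w₂ + (w₃ + (w₄ + 0))))))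
      rearrange = solve-∀

  occ-coverPaths : ∀ m Us S → occᴹ m (concat (coverPaths Us S)) ≡ δᴹ m uvtx + (copies m (matched S) + copies m Us)
  occ-coverPaths m Us S = begin
    occᴹ m (firstPath Us S ++ concat (pairPaths (drop 4 Us)))
      ≡⟨ OccMVert.occ-++ m (firstPath Us S) _ ⟩
    occᴹ m (firstPath Us S) + occᴹ m (concat (pairPaths (drop 4 Us)))
      ≡⟨ cong₂ _+_ (occ-firstPath m Us S) (occ-pairPaths m (drop 4 Us)) ⟩
    δᴹ m uvtx + (copies m (matched S) + copies m (take 4 Us)) + copies m (drop 4 Us)
      ≡⟨ reassoc (δᴹ m uvtx) (copies m (matched S)) _ _ ⟩
    δᴹ m uvtx + (copies m (matched S) + (copies m (take 4 Us) + copies m (drop 4 Us)))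
      ≡⟨ cong (λ k → δᴹ m uvtx + (copies m (matched S) + k)) (trans (sym (copies-++ m (take 4 Us) (drop 4 Us))) (cong (copies m) (take++drop≡id 4 Us))) ⟩
    δᴹ m uvtx + (copies m (matched S) + copies m Us) ∎
    where
      open ≡-Reasoning
      reassoc : ∀ u X a b → u + (X + a) + b ≡ u + (X + (a + b))
      reassoc = solve-∀

  length-coverPaths : ∀ Us S → (length (coverPaths Us S) ≡ 1) ⊎ (2 * length (coverPaths Us S) ≤ length Us ∸ 1)
  length-coverPaths [] S = inj₁ refl
  length-coverPaths (_ ∷ []) S = inj₁ refl
  length-coverPaths (_ ∷ _ ∷ []) S = inj₁ refl
  length-coverPaths (_ ∷ _ ∷ _ ∷ []) S = inj₁ refl
  length-coverPaths (_ ∷ _ ∷ _ ∷ _ ∷ r) S =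
    inj₂ (subst₂ _≤_ (sym (*-distribˡ-+ 2 1 (length (pairPaths r)))) (cong (2 +_) (+-comm (length r) 1)) (+-monoʳ-≤ 2 (length-pairPaths r)))

  distinct⇒CoAdj-linked : ∀ xs → Linked NotMycAdj xs → (∀ m → occᴹ m xs ≤ 1) → Linked (CoAdj A) xs
  distinct⇒CoAdj-linked [] _ _ = []
  distinct⇒CoAdj-linked (x ∷ []) _ _ = [-]
  distinct⇒CoAdj-linked (x ∷ y ∷ ys) (nonadj ∷ l) once =
    (x≢y , nonadj) ∷ distinct⇒CoAdj-linked (y ∷ ys) l (λ m → ≤-trans (OccMVert.occ-++ʳ m (x ∷ []) (y ∷ ys)) (once m))
    where
      x≢y : x ≢ y
      x≢y refl with once x
      ... | twice rewrite OccMVert.δ-refl x = 1+n≰n (≤-trans (s≤s (m≤m+n 1 _)) twice)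

  distinct⇒CoAdj-linkedAll : ∀ pss → All (Linked NotMycAdj) pss → (∀ m → occᴹ m (concat pss) ≤ 1) →
    All (Linked (CoAdj A)) pss
  distinct⇒CoAdj-linkedAll [] [] _ = []
  distinct⇒CoAdj-linkedAll (ps ∷ pss) (l ∷ ls) once =
    distinct⇒CoAdj-linked ps l (λ m → ≤-trans (OccMVert.occ-++ˡ m ps (concat pss)) (once m))
    ∷ distinct⇒CoAdj-linkedAll pss ls (λ m → ≤-trans (OccMVert.occ-++ʳ m ps (concat pss)) (once m))

  module _ (M : StarMatching (complement A)) where

    unmatched : List (Fin n)
    unmatched = filterᵇ (λ x → occ x (matched (stars M)) ≡ᵇ 0) (allFin n)

    matched-or-unmatched : ∀ x → occ x (matched (stars M)) + occ x unmatched ≡ 1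
    matched-or-unmatched x rewrite occ-filterᵇ-allFin (λ y → occ y (matched (stars M)) ≡ᵇ 0) x
      with occ x (matched (stars M)) | OccFin.Unique⇒occ≤1 (disjoint M) x
    ... | zero | _ = refl
    ... | suc zero | _ = refl
    ... | suc (suc _) | s≤s ()

    length-unmatched : length unmatched ≡ n ∸ smSize M
    length-unmatched = sym (trans (cong (_∸ length V) (sym total)) (m+n∸m≡n (length V) (length unmatched)))
      where
        V = matched (stars M)
        total : length V + length unmatched ≡ n
        total = begin
          length V + length unmatched                                  ≡⟨ cong₂ _+_ (sym (sumFin-occ n V)) (sym (sumFin-occ n unmatched)) ⟩
          sumFin n (λ x → occ x V) + sumFin n (λ x → occ x unmatched)  ≡⟨ sym (sumFin-+ n _ _) ⟩
          sumFin n (λ x → occ x V + occ x unmatched)                   ≡⟨ sumFin-cong n matched-or-unmatched ⟩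
          sumFin n (λ _ → 1)                                           ≡⟨ trans (sumFin-const n 1) (*-identityʳ n) ⟩
          n                                                            ∎
          where open ≡-Reasoning

    coverPaths-partition : ∀ m → occᴹ m (concat (coverPaths unmatched (stars M))) ≡ 1
    coverPaths-partition m = trans (occ-coverPaths m unmatched (stars M)) (once m)
      where
        once : ∀ m → δᴹ m uvtx + (copies m (matched (stars M)) + copies m unmatched) ≡ 1
        once uvtx rewrite copies-uvtx (matched (stars M)) | copies-uvtx unmatched = refl
        once (vtx i) rewrite copies-vtx i (matched (stars M)) | copies-vtx i unmatched
          | +-identityʳ (occ i (matched (stars M))) | +-identityʳ (occ i unmatched) = matched-or-unmatched i
        once (vtx′ i) rewrite copies-vtx′ i (matched (stars M)) | copies-vtx′ i unmatched = matched-or-unmatched i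

    upperBound : Σ (MPathCover A) (λ C → (length (mpaths C) ≡ 1) ⊎ (2 * length (mpaths C) ≤ (n ∸ smSize M) ∸ 1))
    upperBound = record
      { mpaths = coverPaths unmatched (stars M)
      ; mnonempty = firstPath-nonempty unmatched (stars M) ∷ pairPaths-nonempty (drop 4 unmatched)
      ; mlinked = distinct⇒CoAdj-linkedAll _ (firstPath-linked unmatched (stars M) ∷ pairPaths-linked (drop 4 unmatched))
                    (λ m → ≤-reflexive (coverPaths-partition m))
      ; partition = coverPaths-partition
      } , subst (λ k → (length (coverPaths unmatched (stars M)) ≡ 1) ⊎ (2 * length (coverPaths unmatched (stars M)) ≤ k ∸ 1))
                length-unmatched (length-coverPaths unmatched (stars M))

-- Arithmetic and the theorem

n≤2*⌈n/2⌉ : ∀ i → i ≤ 2 * ⌈ i /2⌉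
n≤2*⌈n/2⌉ zero = z≤n
n≤2*⌈n/2⌉ (suc zero) = s≤s z≤n
n≤2*⌈n/2⌉ (suc (suc i)) = subst (suc (suc i) ≤_) (sym (*-suc 2 ⌈ i /2⌉)) (s≤s (s≤s (n≤2*⌈n/2⌉ i)))

2*⌈n/2⌉≤n+1 : ∀ i → 2 * ⌈ i /2⌉ ≤ i + 1
2*⌈n/2⌉≤n+1 zero = z≤n
2*⌈n/2⌉≤n+1 (suc zero) = s≤s (s≤s z≤n)
2*⌈n/2⌉≤n+1 (suc (suc i)) = subst (_≤ suc (suc i) + 1) (sym (*-suc 2 ⌈ i /2⌉)) (s≤s (s≤s (2*⌈n/2⌉≤n+1 i)))

2*m≤2*n+1⇒m≤n : ∀ a b → 2 * a ≤ 2 * b + 1 → a ≤ b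
2*m≤2*n+1⇒m≤n a b h = ≤-pred (*-cancelˡ-< 2 a (suc b) (≤-trans (s≤s h) (≤-reflexive (2b+2 b))))
  where
    2b+2 : ∀ b → suc (2 * b + 1) ≡ 2 * suc b
    2b+2 = solve-∀

⌈n/2⌉-unique : ∀ i r → i ≤ 2 * r → 2 * r ≤ i + 1 → ⌈ i /2⌉ ≡ r
⌈n/2⌉-unique i r i≤2r 2r≤i+1 = ≤-antisym
  (2*m≤2*n+1⇒m≤n _ _ (≤-trans (2*⌈n/2⌉≤n+1 i) (+-monoˡ-≤ 1 i≤2r)))
  (2*m≤2*n+1⇒m≤n _ _ (≤-trans 2r≤i+1 (+-monoˡ-≤ 1 (n≤2*⌈n/2⌉ i))))

-- With i = i₄ and p = p_v, the two bounds pin p down.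
bounds⇒cases : ∀ i p → 1 ≤ p → (p ≤ 1 ⊎ 2 * p ≤ i ∸ 1) → i ≤ 2 * p + 2 →
  (p ≡ 1 × i ≤ 4) ⊎ (2 ≤ p × ⌈ i /2⌉ ≡ suc p)
bounds⇒cases i (suc zero) _ _ lower = inj₁ (refl , lower)
bounds⇒cases i (suc (suc p)) _ (inj₁ (s≤s ())) _
bounds⇒cases i (suc (suc p)) _ (inj₂ upper) lower =
  inj₂ (s≤s (s≤s z≤n) , ⌈n/2⌉-unique i (3 + p) (subst (i ≤_) (twice (suc (suc p))) lower) (twice+1≤ i upper))
  where
    twice : ∀ k → 2 * k + 2 ≡ 2 * suc k
    twice = solve-∀
    twice+1≤ : ∀ i → 2 * suc (suc p) ≤ i ∸ 1 → 2 * (3 + p) ≤ i + 1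
    twice+1≤ zero ()
    twice+1≤ (suc i) h = subst₂ _≤_ (twice (suc (suc p))) (+-suc i 1) (+-monoˡ-≤ 2 h)

cases⇒statement : ∀ i p → (p ≡ 1 × i ≤ 4) ⊎ (2 ≤ p × ⌈ i /2⌉ ≡ suc p) →
  ((i ≤ 4) ⇔ (p ≡ 1)) × (∀ (r : ℕ) → 3 ≤ r → ((⌈ i /2⌉ ≡ r) ⇔ (p ≡ r ∸ 1)))
cases⇒statement i p (inj₁ (refl , i≤4)) = mk⇔ (λ _ → refl) (λ _ → i≤4) , λ r 3≤r →
  mk⇔ (λ ⌈i/2⌉≡r → contradiction (≤-trans 3≤r (subst (_≤ 2) ⌈i/2⌉≡r (⌈n/2⌉-mono i≤4))) λ { (s≤s (s≤s ())) })
      (λ 1≡r∸1 → contradiction (subst (2 ≤_) (sym 1≡r∸1) (∸-monoˡ-≤ 1 3≤r)) λ { (s≤s ()) })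
cases⇒statement i p (inj₂ (2≤p , ⌈i/2⌉≡1+p)) =
  mk⇔ (λ i≤4 → contradiction (≤-trans (s≤s 2≤p) (subst (_≤ 2) ⌈i/2⌉≡1+p (⌈n/2⌉-mono i≤4))) λ { (s≤s (s≤s ())) })
      (λ { refl → contradiction 2≤p λ { (s≤s ()) } }) ,
  λ { (suc r) _ → mk⇔ (λ ⌈i/2⌉≡r → suc-injective (trans (sym ⌈i/2⌉≡1+p) ⌈i/2⌉≡r)) (λ p≡r → trans ⌈i/2⌉≡1+p (cong suc p≡r)) }

covered⇒nonempty : ∀ {k} {A : Adj k} (ps : List (Path A)) {z : Fin k} → z ∈ concat (map verts ps) → 1 ≤ length ps
covered⇒nonempty (P ∷ ps) _ = s≤s z≤n

theorem3p3 : ∀ (n : ℕ) (G : Graph n) (s p : ℕ) →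
    IsS4 (complement (adj G)) s →
    IsPathCoverNumber (complement (mycielski (adj G))) p →
    ((n ∸ s ≤ 4) ⇔ (p ≡ 1))
    × (∀ (r : ℕ) → 3 ≤ r → ((⌈ (n ∸ s) /2⌉ ≡ r) ⇔ (p ≡ r ∸ 1)))
theorem3p3 n G s p ((M , size≡s) , s-maximal) ((C , length≡p) , p-minimal) =
  cases⇒statement (n ∸ s) p (bounds⇒cases (n ∸ s) p p≥1 upper lower)
  where
    p≥1 : 1 ≤ p
    p≥1 = subst (1 ≤_) length≡p (covered⇒nonempty (paths C) (covers C zero))

    upper : p ≤ 1 ⊎ 2 * p ≤ (n ∸ s) ∸ 1
    upper with UpperBound.upperBound G M
    ... | C′ , short with toPathCover (adj G) C′
    ...   | C″ , length≡ with p-minimal C″ | short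
    ...     | p≤ | inj₁ one = inj₁ (subst (p ≤_) (trans length≡ one) p≤)
    ...     | p≤ | inj₂ few = inj₂ (≤-trans (*-monoʳ-≤ 2 (subst (p ≤_) length≡ p≤)) (subst (λ k → _ ≤ (n ∸ k) ∸ 1) size≡s few))

    lower : n ∸ s ≤ 2 * p + 2
    lower with fromPathCover (adj G) C
    ... | C′ , length≡ with LowerBound.lowerBound G C′
    ...   | M′ , covered = m≤n+o⇒m∸n≤o n s (≤-trans covered (+-mono-≤ (s-maximal M′) (≤-reflexive (cong (λ k → 2 * k + 2) (trans length≡ length≡p)))))
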